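{- Fix $r\ge2$, $\ell\ge1$, $C\ge0$. For each $n$ let $D_1,\dots,D_\ell$ be pairwise edge-disjoint subgraphs of $K_{r\times(r-1)n}$ (parts $V_1,\dots,V_r$) with $\Delta(D_m)\le C$, and let $d_{m,i,j}$ be the number of edges of $D_m$ between $V_i$ and $V_j$, $\mathbf d=(d_{m,i,j})_{m\in[\ell],i<j\in[r]}$. Then for every $\mathbf x\in\mathbb N^{\ell\times\binom r2}$, \[\mu_{\mathbf x}=\frac{(\mathbf d-O(|\mathbf x|)\mathbf 1)^{\mathbf x}}{\mathbf x!},\] meaning: there is a constant $K$ depending only on $C$ such that for all $n,\mathbf x$ one can write $\mu_{\mathbf x}=\frac{1}{\mathbf x!}\prod_{m}\prod_{i<j}\prod_{k=1}^{x_{m,i,j}}(d_{m,i,j}-c_{m,i,j,k})$ with reals $|c_{m,i,j,k}|\le K|\mathbf x|$.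
   Context: $\mathbf x=(x_{m,i,j})_{m\in[\ell],i<j\in[r]}$, $|\mathbf x|=\sum x_{m,i,j}$, $\mathbf x!=\prod x_{m,i,j}!$. An $\mathbf x$-matching of $K_{r\times(r-1)n}$ is a matching with $|\mathbf x|$ edges such that, for each $m$ and $i<j$, exactly $x_{m,i,j}$ of its edges lie in $D_m$ and join $V_i$ to $V_j$; $\mu_{\mathbf x}$ is the number of $\mathbf x$-matchings. $K_{r\times(r-1)n}$ is the complete $r$-partite graph with parts of size $(r-1)n$. -}

module Defs where

open import Data.Bool using (Bool; true; false; T; _∧_; _∨_; not)
open import Data.Nat using (ℕ; zero; suc; _+_; _*_; _∸_; _≤_; _≡ᵇ_; _<ᵇ_; _!)
open import Data.Nat.ListAction using (sum; product)
open import Data.Bool.ListAction using (all)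
open import Data.Fin using (Fin; toℕ)
open import Data.Product using (_×_; _,_; proj₁; proj₂)
open import Data.List using (List; []; _∷_; _++_; map; length; filterᵇ; concatMap;
  cartesianProduct; allFin; foldr; upTo)
open import Data.Empty using (⊥)
open import Relation.Binary.PropositionalEquality using (_≡_; _≢_)
open import Data.Integer using (+_)
import Data.Rational as ℚ
open ℚ using (ℚ; _/_)

-- Vertices of K_{r × N}: part index i ∈ Fin r, position a ∈ Fin N inside V_i.
Vertex : ℕ → ℕ → Set
Vertex r N = Fin r × Fin N

allVertices : (r N : ℕ) → List (Vertex r N)
allVertices r N = cartesianProduct (allFin r) (allFin N)

Graph : ℕ → ℕ → Set
Graph r N = Vertex r N → Vertex r N → Bool

IsSubgraphOfComplete : ∀ {r N} → Graph r N → Set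
IsSubgraphOfComplete {r} {N} D =
  (∀ (u v : Vertex r N) → D u v ≡ D v u) ×
  (∀ (u v : Vertex r N) → T (D u v) → proj₁ u ≢ proj₁ v)

degree : ∀ {r N} → Graph r N → Vertex r N → ℕ
degree {r} {N} D v = length (filterᵇ (D v) (allVertices r N))

MaxDegreeAtMost : ∀ {r N} → Graph r N → ℕ → Set
MaxDegreeAtMost {r} {N} D C = ∀ (v : Vertex r N) → degree D v ≤ C

PairwiseEdgeDisjoint : ∀ {ℓ r N} → (Fin ℓ → Graph r N) → Set
PairwiseEdgeDisjoint {ℓ} {r} {N} Ds =
  ∀ (m m' : Fin ℓ) → m ≢ m' → ∀ (u v : Vertex r N) → T (Ds m u v) → T (Ds m' u v) → ⊥

pairs : (r : ℕ) → List (Fin r × Fin r)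
pairs r = filterᵇ (λ p → toℕ (proj₁ p) <ᵇ toℕ (proj₂ p)) (cartesianProduct (allFin r) (allFin r))

dCount : ∀ {ℓ r N} → (Fin ℓ → Graph r N) → Fin ℓ → Fin r → Fin r → ℕ
dCount {ℓ} {r} {N} Ds m i j =
  length (filterᵇ (λ ab → Ds m (i , proj₁ ab) (j , proj₂ ab)) (cartesianProduct (allFin N) (allFin N)))

-- An edge of D_m joining (i , a) ∈ V_i to (j , b) ∈ V_j, stored with i < j.
record Edge (ℓ r N : ℕ) : Set where
  constructor edge
  field
    col : Fin ℓ
    i j : Fin r
    a b : Fin N

-- The list of all edges of D_1 ∪ … ∪ D_ℓ (each edge exactly once, labelled by its D_m).
allEdges : ∀ {ℓ r N} → (Fin ℓ → Graph r N) → List (Edge ℓ r N)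
allEdges {ℓ} {r} {N} Ds =
  concatMap (λ m →
    concatMap (λ ij →
      map (λ ab → edge m (proj₁ ij) (proj₂ ij) (proj₁ ab) (proj₂ ab))
        (filterᵇ (λ ab → Ds m (proj₁ ij , proj₁ ab) (proj₂ ij , proj₂ ab))
          (cartesianProduct (allFin N) (allFin N))))
      (pairs r))
    (allFin ℓ)

-- all sublists (= all subsets of a duplicate-free list)
sublists : ∀ {A : Set} → List A → List (List A)
sublists [] = [] ∷ []
sublists (x ∷ xs) = sublists xs ++ map (x ∷_) (sublists xs)

finEq : ∀ {k} → Fin k → Fin k → Bool
finEq p q = toℕ p ≡ᵇ toℕ q

vertexEq : ∀ {r N} → Vertex r N → Vertex r N → Bool
vertexEq (i , a) (j , b) = finEq i j ∧ finEq a b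

endpoints : ∀ {ℓ r N} → Edge ℓ r N → Vertex r N × Vertex r N
endpoints (edge m i j a b) = (i , a) , (j , b)

shareVertex : ∀ {ℓ r N} → Edge ℓ r N → Edge ℓ r N → Bool
shareVertex e e' with endpoints e | endpoints e'
... | (u , v) | (u' , v') = vertexEq u u' ∨ vertexEq u v' ∨ vertexEq v u' ∨ vertexEq v v'

isMatching : ∀ {ℓ r N} → List (Edge ℓ r N) → Bool
isMatching [] = true
isMatching (e ∷ es) = all (λ e' → not (shareVertex e e')) es ∧ isMatching es

hasType : ∀ {ℓ r N} → Fin ℓ → Fin r → Fin r → Edge ℓ r N → Bool
hasType m i j (edge m' i' j' _ _) = finEq m m' ∧ finEq i i' ∧ finEq j j'

-- x = (x_{m,i,j}) : only the entries with i < j are used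
Vector : ℕ → ℕ → Set
Vector ℓ r = Fin ℓ → Fin r → Fin r → ℕ

isXMatching : ∀ {ℓ r N} → Vector ℓ r → List (Edge ℓ r N) → Bool
isXMatching {ℓ} {r} x M =
  isMatching M ∧
  all (λ m → all (λ ij → length (filterᵇ (hasType m (proj₁ ij) (proj₂ ij)) M) ≡ᵇ x m (proj₁ ij) (proj₂ ij))
                 (pairs r))
      (allFin ℓ)

μ : ∀ {ℓ r N} → (Fin ℓ → Graph r N) → Vector ℓ r → ℕ
μ Ds x = length (filterᵇ (isXMatching x) (sublists (allEdges Ds)))

norm : ∀ {ℓ r} → Vector ℓ r → ℕ
norm {ℓ} {r} x = sum (concatMap (λ m → map (λ ij → x m (proj₁ ij) (proj₂ ij)) (pairs r)) (allFin ℓ))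

factVec : ∀ {ℓ r} → Vector ℓ r → ℕ
factVec {ℓ} {r} x = product (concatMap (λ m → map (λ ij → (x m (proj₁ ij) (proj₂ ij)) !) (pairs r)) (allFin ℓ))

ℕtoℚ : ℕ → ℚ
ℕtoℚ n = (+ n) / 1

prodℚ : List ℚ → ℚ
prodℚ = foldr ℚ._*_ ℚ.1ℚ

-- Π_m Π_{i<j} Π_{k=1}^{x_{m,i,j}} (d_{m,i,j} - c_{m,i,j,k})   (k runs over 0 … x_{m,i,j}-1 here)
shiftedPower : ∀ {ℓ r} → Vector ℓ r → Vector ℓ r → (Fin ℓ → Fin r → Fin r → ℕ → ℚ) → ℚ
shiftedPower {ℓ} {r} d x c =
  prodℚ (concatMap (λ m → concatMap (λ ij →
     map (λ k → ℕtoℚ (d m (proj₁ ij) (proj₂ ij)) ℚ.- c m (proj₁ ij) (proj₂ ij) k)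
         (upTo (x m (proj₁ ij) (proj₂ ij))))
    (pairs r)) (allFin ℓ))

{-# OPTIONS --safe #-}
module Submission where

-- Call a pair (M , e) an extension when M is an (x − e_t)-matching and e is an edge of
-- type t vertex-disjoint from M. Adding e to M gives an x-matching with a marked edge of
-- type t, so there are exactly x_t μ_x extensions. For fixed M, at most 4C|x| of the d_t
-- edges of type t meet M: each endpoint of an edge of M lies on at most C edges of D_m,
-- at either end of a type-t edge. Hence d_t μ_{x−e_t} − 4C|x| μ_{x−e_t} ≤ x_t μ_x ≤ d_t μ_{x−e_t},
-- that is x_t μ_x = μ_{x−e_t} (d_t − c) for a rational c ∈ [0, 4C|x|], and induction on |x|
-- multiplies these factors into μ_x x! = ∏ (d − c).

open import Algebra.Bundles using (CommutativeMonoid)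
import Algebra.Properties.CommutativeSemigroup as CommutativeSemigroupProperties
open import Data.Bool using (Bool; true; false; _∧_; _∨_; not; T?; if_then_else_)
open import Data.Bool.ListAction using (all)
open import Data.Bool.Properties using (∧-commutativeMonoid; ∧-zeroʳ; ∧-identityʳ; ∧-conicalˡ; ∧-conicalʳ; T-≡)
open import Data.Bool.Solver using (module ∨-∧-Solver)
open import Data.Fin using (Fin; toℕ) renaming (zero to fzero; suc to fsuc)
open import Data.Fin.Properties using (toℕ-injective)
import Data.Integer as ℤ
import Data.Integer.Properties as ℤ
open import Data.List using (List; []; _∷_; _++_; map; foldr; concatMap; length; filterᵇ; cartesianProduct; allFin; upTo)
import Data.List.Properties as List
open import Data.List.Membership.Propositional using (_∈_)
open import Data.List.Membership.Propositional.Properties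
  using (∈-allFin; ∈-cartesianProduct⁺; ∈-cartesianProduct⁻; ∈-filter⁺; ∈-filter⁻; ∈-++⁻; ∈-map⁻; ∈-upTo⁻)
open import Data.List.Relation.Unary.All as All using (All; []; _∷_)
open import Data.List.Relation.Unary.All.Properties using (concat⁺; map⁺)
open import Data.List.Relation.Unary.Any using (here; there)
open import Data.Nat using (ℕ; zero; suc; _+_; _*_; _∸_; _≤_; _<_; z≤n; s≤s; z<s; s<s; s≤s⁻¹; _≡ᵇ_; _<ᵇ_; _!)
open import Data.Nat.Coprimality using (1-coprimeTo) renaming (sym to coprime-sym)
open import Data.Nat.ListAction using (sum)
open import Data.Nat.Properties
open import Data.Product using (Σ; _×_; _,_; proj₁; proj₂)
open import Data.Rational as ℚ using (ℚ; mkℚ; 0ℚ; ∣_∣) renaming (_+_ to _+ℚ_; _*_ to _*ℚ_; _-_ to _-ℚ_; _≤_ to _≤ℚ_)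
import Data.Rational.Properties as ℚ
open import Data.Rational.Solver using (module +-*-Solver)
open import Data.Sum using (inj₁; inj₂)
open import Function using (_∘_; id)
open import Function.Bundles using (Equivalence)
open import Relation.Binary.PropositionalEquality using (_≡_; _≢_; refl; sym; trans; cong; cong₂; subst; subst₂; module ≡-Reasoning)
import Relation.Binary.Reasoning.Setoid as SetoidReasoning
open import Defs
  using ( finEq; ℕtoℚ; pairs; Vector; Vertex; vertexEq; Graph; IsSubgraphOfComplete; PairwiseEdgeDisjoint; MaxDegreeAtMost
        ; degree; allVertices; Edge; edge; allEdges; shareVertex; isMatching; isXMatching; sublists; μ; dCount; norm
        ; factVec; prodℚ; shiftedPower)

module ℕ* = CommutativeSemigroupProperties *-commutativeSemigroup
module ℚ* = CommutativeSemigroupProperties (CommutativeMonoid.commutativeSemigroup ℚ.*-1-commutativeMonoid)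

private
  variable
    A B : Set

-- Big operators over lists

𝟙 : Bool → ℕ
𝟙 true = 1
𝟙 false = 0

𝟙-∧ : ∀ a b → 𝟙 (a ∧ b) ≡ 𝟙 a * 𝟙 b
𝟙-∧ true b = sym (+-identityʳ (𝟙 b))
𝟙-∧ false b = refl

𝟙≤1 : ∀ b → 𝟙 b ≤ 1
𝟙≤1 true = ≤-refl
𝟙≤1 false = z≤n

𝟙-∧-comm : ∀ a b → 𝟙 (a ∧ b) ≡ 𝟙 b * 𝟙 a
𝟙-∧-comm a b = trans (𝟙-∧ a b) (*-comm (𝟙 a) (𝟙 b))

𝟙-∧-left-comm : ∀ a b c → 𝟙 (a ∧ (b ∧ c)) ≡ 𝟙 b * 𝟙 (a ∧ c)
𝟙-∧-left-comm a b c = trans (cong 𝟙 (∧-left-comm a b c)) (𝟙-∧ b (a ∧ c))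
  where
  ∧-left-comm : ∀ a b c → a ∧ (b ∧ c) ≡ b ∧ (a ∧ c)
  ∧-left-comm = solve 3 (λ a b c → a :* (b :* c) := b :* (a :* c)) refl
    where open ∨-∧-Solver

𝟙-∧-rotate : ∀ a b c → 𝟙 (a ∧ (b ∧ c)) ≡ 𝟙 b * (𝟙 c * 𝟙 a)
𝟙-∧-rotate a b c = trans (cong 𝟙 (∧-rotate a b c)) (trans (𝟙-∧ b (c ∧ a)) (cong (𝟙 b *_) (𝟙-∧ c a)))
  where
  ∧-rotate : ∀ a b c → a ∧ (b ∧ c) ≡ b ∧ (c ∧ a)
  ∧-rotate = solve 3 (λ a b c → a :* (b :* c) := b :* (c :* a)) refl
    where open ∨-∧-Solver

∑ : (A → ℕ) → List A → ℕ
∑ f xs = sum (map f xs)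

count : (A → Bool) → List A → ℕ
count p = ∑ (𝟙 ∘ p)

count≡0⇒false : ∀ (p : A → Bool) xs → count p xs ≡ 0 → ∀ {a} → a ∈ xs → p a ≡ false
count≡0⇒false p (y ∷ xs) h (here refl) with p y
... | false = refl
count≡0⇒false p (y ∷ xs) h (there a∈xs) with p y
... | false = count≡0⇒false p xs h a∈xs

module BigOperator {c ℓ} (M : CommutativeMonoid c ℓ) where
  open CommutativeMonoid M
    using (Carrier; _≈_; _∙_; ε; setoid; commutativeSemigroup; ∙-cong; ∙-congˡ; assoc; identityˡ)
    renaming (refl to ≈-refl; reflexive to ≈-reflexive; sym to ≈-sym; trans to ≈-trans)
  open CommutativeSemigroupProperties commutativeSemigroup using (xy∙z≈xz∙y; interchange)
  open SetoidReasoning setoid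

  fold : List Carrier → Carrier
  fold = foldr _∙_ ε

  big : (A → Carrier) → List A → Carrier
  big f xs = fold (map f xs)

  fold-++ : ∀ xs ys → fold (xs ++ ys) ≈ fold xs ∙ fold ys
  fold-++ [] ys = ≈-sym (identityˡ (fold ys))
  fold-++ (x ∷ xs) ys = begin
    x ∙ fold (xs ++ ys)         ≈⟨ ∙-congˡ (fold-++ xs ys) ⟩
    x ∙ (fold xs ∙ fold ys)     ≈⟨ ≈-sym (assoc x (fold xs) (fold ys)) ⟩
    x ∙ fold xs ∙ fold ys       ∎

  fold-concatMap : ∀ (g : A → List Carrier) xs → fold (concatMap g xs) ≈ big (fold ∘ g) xs
  fold-concatMap g [] = ≈-refl
  fold-concatMap g (x ∷ xs) = ≈-trans (fold-++ (g x) (concatMap g xs)) (∙-congˡ (fold-concatMap g xs))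

  big-++ : ∀ (f : A → Carrier) xs ys → big f (xs ++ ys) ≈ big f xs ∙ big f ys
  big-++ f xs ys = ≈-trans (≈-reflexive (cong fold (List.map-++ f xs ys))) (fold-++ (map f xs) (map f ys))

  big-concatMap : ∀ (f : B → Carrier) (g : A → List B) xs → big f (concatMap g xs) ≈ big (big f ∘ g) xs
  big-concatMap f g xs = ≈-trans (≈-reflexive (cong fold (List.map-concatMap f g xs))) (fold-concatMap (map f ∘ g) xs)

  big-map : ∀ (f : B → Carrier) (g : A → B) xs → big f (map g xs) ≈ big (f ∘ g) xs
  big-map f g [] = ≈-refl
  big-map f g (x ∷ xs) = ∙-congˡ (big-map f g xs)

  big-cong : ∀ {f g : A → Carrier} xs → (∀ {a} → a ∈ xs → f a ≈ g a) → big f xs ≈ big g xs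
  big-cong [] h = ≈-refl
  big-cong (x ∷ xs) h = ∙-cong (h (here refl)) (big-cong xs (h ∘ there))

  big-∙ : ∀ (f g : A → Carrier) xs → big (λ x → f x ∙ g x) xs ≈ big f xs ∙ big g xs
  big-∙ f g [] = ≈-sym (identityˡ ε)
  big-∙ f g (x ∷ xs) = ≈-trans (∙-congˡ (big-∙ f g xs)) (interchange (f x) (g x) (big f xs) (big g xs))

  big-ε : ∀ (xs : List A) → big (λ _ → ε) xs ≈ ε
  big-ε [] = ≈-refl
  big-ε (x ∷ xs) = ≈-trans (∙-congˡ (big-ε xs)) (identityˡ ε)

  big-swap : ∀ (f : A → B → Carrier) xs ys → big (λ a → big (f a) ys) xs ≈ big (λ b → big (λ a → f a b) xs) ys
  big-swap f [] ys = ≈-sym (big-ε ys)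
  big-swap f (x ∷ xs) ys = ≈-trans (∙-congˡ (big-swap f xs ys)) (≈-sym (big-∙ (f x) (λ b → big (λ a → f a b) xs) ys))

  big-cartesianProduct : ∀ (f : A × B → Carrier) xs ys →
    big f (cartesianProduct xs ys) ≈ big (λ a → big (λ b → f (a , b)) ys) xs
  big-cartesianProduct f [] ys = ≈-refl
  big-cartesianProduct f (x ∷ xs) ys =
    ≈-trans (big-++ f (map (x ,_) ys) (cartesianProduct xs ys))
            (∙-cong (big-map f (x ,_) ys) (big-cartesianProduct f xs ys))

  big-extract : ∀ (p : A → Bool) (f g : A → Carrier) R xs → count p xs ≡ 1 →
    (∀ {a} → a ∈ xs → p a ≡ false → f a ≈ g a) → (∀ {a} → p a ≡ true → f a ≈ g a ∙ R) →
    big f xs ≈ big g xs ∙ R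
  big-extract p f g R (y ∷ xs) once off on with p y in py
  ... | true = begin
    f y ∙ big f xs      ≈⟨ ∙-cong (on py) (big-cong xs λ a∈ → off (there a∈) (count≡0⇒false p xs (suc-injective once) a∈)) ⟩
    g y ∙ R ∙ big g xs  ≈⟨ xy∙z≈xz∙y (g y) R (big g xs) ⟩
    g y ∙ big g xs ∙ R  ∎
  ... | false = begin
    f y ∙ big f xs        ≈⟨ ∙-cong (off (here refl) py) (big-extract p f g R xs once (off ∘ there) on) ⟩
    g y ∙ (big g xs ∙ R)  ≈⟨ ≈-sym (assoc (g y) (big g xs) R) ⟩
    g y ∙ big g xs ∙ R    ∎

open BigOperator +-0-commutativeMonoid
  using ()
  renaming ( big-++ to ∑-++; big-concatMap to ∑-concatMap; big-map to ∑-map; big-cong to ∑-cong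
           ; big-∙ to ∑-+; big-swap to ∑-swap; big-cartesianProduct to ∑-cartesianProduct; big-extract to ∑-extract; fold-concatMap to sum-concatMap)

module _ {A : Set} where

  ∑-*ˡ : ∀ k (f : A → ℕ) xs → ∑ (λ x → k * f x) xs ≡ k * ∑ f xs
  ∑-*ˡ k f [] = sym (*-zeroʳ k)
  ∑-*ˡ k f (x ∷ xs) = trans (cong (k * f x +_) (∑-*ˡ k f xs)) (sym (*-distribˡ-+ k (f x) (∑ f xs)))

  ∑-*ʳ : ∀ k (f : A → ℕ) xs → ∑ (λ x → f x * k) xs ≡ ∑ f xs * k
  ∑-*ʳ k f xs = trans (∑-cong xs (λ {x} _ → *-comm (f x) k)) (trans (∑-*ˡ k f xs) (*-comm k (∑ f xs)))

  ∑-const : ∀ k (xs : List A) → ∑ (λ _ → k) xs ≡ k * length xs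
  ∑-const k [] = sym (*-zeroʳ k)
  ∑-const k (x ∷ xs) = trans (cong (k +_) (∑-const k xs)) (sym (*-suc k (length xs)))

  ∑-mono-≤ : ∀ {f g : A → ℕ} xs → (∀ {x} → x ∈ xs → f x ≤ g x) → ∑ f xs ≤ ∑ g xs
  ∑-mono-≤ [] h = z≤n
  ∑-mono-≤ (x ∷ xs) h = +-mono-≤ (h (here refl)) (∑-mono-≤ xs (h ∘ there))

  ∈⇒≤∑ : ∀ (f : A → ℕ) {x} {xs} → x ∈ xs → f x ≤ ∑ f xs
  ∈⇒≤∑ f {xs = y ∷ xs} (here refl) = m≤m+n (f y) (∑ f xs)
  ∈⇒≤∑ f {xs = y ∷ xs} (there x∈) = ≤-trans (∈⇒≤∑ f x∈) (m≤n+m (∑ f xs) (f y))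

  ∑≡0⇒≡0 : ∀ (f : A → ℕ) {x} {xs} → ∑ f xs ≡ 0 → x ∈ xs → f x ≡ 0
  ∑≡0⇒≡0 f {xs = y ∷ xs} h (here refl) = m+n≡0⇒m≡0 (f y) h
  ∑≡0⇒≡0 f {xs = y ∷ xs} h (there x∈) = ∑≡0⇒≡0 f (m+n≡0⇒n≡0 (f y) h) x∈

  ∑>0⇒∃ : ∀ (f : A → ℕ) xs {n} → ∑ f xs ≡ suc n → Σ A λ x → x ∈ xs × 0 < f x
  ∑>0⇒∃ f (y ∷ xs) h with f y in fy
  ... | suc _ = y , here refl , subst (0 <_) (sym fy) z<s
  ... | zero with ∑>0⇒∃ f xs h
  ...   | x , x∈ , fx>0 = x , there x∈ , fx>0

  length-filterᵇ : ∀ (p : A → Bool) xs → length (filterᵇ p xs) ≡ count p xs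
  length-filterᵇ p [] = refl
  length-filterᵇ p (x ∷ xs) with p x
  ... | true = cong suc (length-filterᵇ p xs)
  ... | false = length-filterᵇ p xs

  count-filterᵇ : ∀ (p q : A → Bool) xs → count q (filterᵇ p xs) ≡ count (λ x → p x ∧ q x) xs
  count-filterᵇ p q [] = refl
  count-filterᵇ p q (x ∷ xs) with p x
  ... | true = cong (𝟙 (q x) +_) (count-filterᵇ p q xs)
  ... | false = count-filterᵇ p q xs

∑-allFin-suc : ∀ n (h : Fin (suc n) → ℕ) → ∑ h (allFin (suc n)) ≡ h fzero + ∑ (h ∘ fsuc) (allFin n)
∑-allFin-suc n h = cong (h fzero +_) (trans (cong (∑ h) (sym (List.map-tabulate id fsuc))) (∑-map h fsuc (allFin n)))

∑-allFin-finEq : ∀ n (c : Fin n) (g : Fin n → ℕ) → ∑ (λ a → 𝟙 (finEq c a) * g a) (allFin n) ≡ g c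
∑-allFin-finEq (suc n) fzero g = begin
  ∑ (λ a → 𝟙 (finEq fzero a) * g a) (allFin (suc n))  ≡⟨ ∑-allFin-suc n _ ⟩
  g fzero + 0 + ∑ (λ _ → 0) (allFin n)                 ≡⟨ cong (g fzero + 0 +_) (∑-const 0 (allFin n)) ⟩
  g fzero + 0 + 0                                      ≡⟨ trans (+-identityʳ _) (+-identityʳ _) ⟩
  g fzero                                              ∎
  where open ≡-Reasoning
∑-allFin-finEq (suc n) (fsuc c) g =
  trans (∑-allFin-suc n (λ a → 𝟙 (finEq (fsuc c) a) * g a)) (∑-allFin-finEq n c (g ∘ fsuc))

module _ {A : Set} where

  count-∧-∨ : ∀ (p q s : A → Bool) xs → count (λ x → p x ∧ (q x ∨ s x)) xs ≤ count (λ x → p x ∧ q x) xs + count (λ x → p x ∧ s x) xs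
  count-∧-∨ p q s xs = ≤-trans (∑-mono-≤ xs (λ {x} _ → pointwise (p x) (q x) (s x))) (≤-reflexive (∑-+ _ _ xs))
    where
    pointwise : ∀ a b c → 𝟙 (a ∧ (b ∨ c)) ≤ 𝟙 (a ∧ b) + 𝟙 (a ∧ c)
    pointwise false b c = z≤n
    pointwise true true c = s≤s z≤n
    pointwise true false c = ≤-refl

  union-bound : ∀ h (p : A → Bool) M → 𝟙 h ≤ 𝟙 (h ∧ all (not ∘ p) M) + count (λ f → h ∧ p f) M
  union-bound false p M = z≤n
  union-bound true p [] = ≤-refl
  union-bound true p (f ∷ M) with p f
  ... | true = s≤s z≤n
  ... | false = union-bound true p M

module _ {N : ℕ} where

  count-finEq-proj₁ : ∀ (c : Fin N) (P : Fin N × Fin N → Bool) →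
    count (λ ab → P ab ∧ finEq c (proj₁ ab)) (cartesianProduct (allFin N) (allFin N)) ≡ count (λ b → P (c , b)) (allFin N)
  count-finEq-proj₁ c P = begin
    count (λ ab → P ab ∧ finEq c (proj₁ ab)) (cartesianProduct (allFin N) (allFin N))
      ≡⟨ ∑-cartesianProduct _ (allFin N) (allFin N) ⟩
    ∑ (λ a → ∑ (λ b → 𝟙 (P (a , b) ∧ finEq c a)) (allFin N)) (allFin N)
      ≡⟨ ∑-cong (allFin N) (λ {a} _ → trans (∑-cong (allFin N) (λ {b} _ → 𝟙-∧-comm (P (a , b)) (finEq c a)))
                                          (∑-*ˡ (𝟙 (finEq c a)) (λ b → 𝟙 (P (a , b))) (allFin N))) ⟩
    ∑ (λ a → 𝟙 (finEq c a) * count (λ b → P (a , b)) (allFin N)) (allFin N)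
      ≡⟨ ∑-allFin-finEq N c _ ⟩
    count (λ b → P (c , b)) (allFin N) ∎
    where open ≡-Reasoning

  count-finEq-proj₂ : ∀ (c : Fin N) (P : Fin N × Fin N → Bool) →
    count (λ ab → P ab ∧ finEq c (proj₂ ab)) (cartesianProduct (allFin N) (allFin N)) ≡ count (λ a → P (a , c)) (allFin N)
  count-finEq-proj₂ c P = begin
    count (λ ab → P ab ∧ finEq c (proj₂ ab)) (cartesianProduct (allFin N) (allFin N))
      ≡⟨ ∑-cartesianProduct _ (allFin N) (allFin N) ⟩
    ∑ (λ a → ∑ (λ b → 𝟙 (P (a , b) ∧ finEq c b)) (allFin N)) (allFin N)
      ≡⟨ ∑-cong (allFin N) (λ {a} _ → trans (∑-cong (allFin N) (λ {b} _ → 𝟙-∧-comm (P (a , b)) (finEq c b)))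
                                          (∑-allFin-finEq N c (λ b → 𝟙 (P (a , b))))) ⟩
    count (λ a → P (a , c)) (allFin N) ∎
    where open ≡-Reasoning

sublists-All : ∀ {A : Set} {P : A → Set} {xs} → All P xs → ∀ {ys} → ys ∈ sublists xs → All P ys
sublists-All {xs = []} [] (here refl) = []
sublists-All {xs = x ∷ xs} (px ∷ pxs) ys∈ with ∈-++⁻ (sublists xs) ys∈
... | inj₁ ys∈′ = sublists-All pxs ys∈′
... | inj₂ ys∈′ with ∈-map⁻ (x ∷_) ys∈′
...   | zs , zs∈ , refl = px ∷ sublists-All pxs zs∈

open BigOperator ∧-commutativeMonoid
  using ()
  renaming (big-∙ to all-∧; big-cong to all-cong; big-cartesianProduct to all-cartesianProduct; big-extract to all-extract)

module _ {A : Set} where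

  all-true⇒∈ : ∀ (p : A → Bool) {x} {xs} → all p xs ≡ true → x ∈ xs → p x ≡ true
  all-true⇒∈ p {xs = y ∷ xs} h (here refl) with p y | h
  ... | true | _ = refl
  all-true⇒∈ p {xs = y ∷ xs} h (there x∈) with p y | h
  ... | true | h′ = all-true⇒∈ p h′ x∈

  ∈-false⇒all-false : ∀ (p : A → Bool) {x} {xs} → x ∈ xs → p x ≡ false → all p xs ≡ false
  ∈-false⇒all-false p {xs = y ∷ xs} (here refl) px rewrite px = refl
  ∈-false⇒all-false p {xs = y ∷ xs} (there x∈) px with p y
  ... | true = ∈-false⇒all-false p x∈ px
  ... | false = refl

  ∀∈-true⇒all-true : ∀ (p : A → Bool) xs → (∀ {x} → x ∈ xs → p x ≡ true) → all p xs ≡ true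
  ∀∈-true⇒all-true p [] h = refl
  ∀∈-true⇒all-true p (x ∷ xs) h rewrite h (here refl) = ∀∈-true⇒all-true p xs (h ∘ there)

open BigOperator *-1-commutativeMonoid
  using ()
  renaming (big to ∏; fold-concatMap to product-concatMap; big-cong to ∏-cong; big-ε to ∏-ε; big-cartesianProduct to ∏-cartesianProduct; big-extract to ∏-extract)

open BigOperator ℚ.*-1-commutativeMonoid
  using ()
  renaming ( big to ∏ℚ; fold-concatMap to prodℚ-concatMap; big-++ to ∏ℚ-++; big-cong to ∏ℚ-cong
           ; big-ε to ∏ℚ-ε; big-cartesianProduct to ∏ℚ-cartesianProduct; big-extract to ∏ℚ-extract)

∏ℚ-upTo-suc : ∀ (h : ℕ → ℚ) n → ∏ℚ h (upTo (suc n)) ≡ ∏ℚ h (upTo n) *ℚ h n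
∏ℚ-upTo-suc h n = begin
  ∏ℚ h (upTo (suc n))               ≡⟨ cong (∏ℚ h) (sym (List.upTo-∷ʳ n)) ⟩
  ∏ℚ h (upTo n ++ n ∷ [])           ≡⟨ ∏ℚ-++ h (upTo n) (n ∷ []) ⟩
  ∏ℚ h (upTo n) *ℚ (h n *ℚ ℚ.1ℚ)     ≡⟨ cong (∏ℚ h (upTo n) *ℚ_) (ℚ.*-identityʳ (h n)) ⟩
  ∏ℚ h (upTo n) *ℚ h n              ∎
  where open ≡-Reasoning

≡ᵇ-refl : ∀ n → (n ≡ᵇ n) ≡ true
≡ᵇ-refl zero = refl
≡ᵇ-refl (suc n) = ≡ᵇ-refl n

≡ᵇ-sym : ∀ m n → (m ≡ᵇ n) ≡ (n ≡ᵇ m)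
≡ᵇ-sym zero zero = refl
≡ᵇ-sym zero (suc n) = refl
≡ᵇ-sym (suc m) zero = refl
≡ᵇ-sym (suc m) (suc n) = ≡ᵇ-sym m n

<⇒≡ᵇfalse : ∀ {m n} → m < n → (m ≡ᵇ n) ≡ false
<⇒≡ᵇfalse {zero} z<s = refl
<⇒≡ᵇfalse {suc m} (s<s m<n) = <⇒≡ᵇfalse m<n

≡ᵇfalse⇒≢ : ∀ {m n} → (m ≡ᵇ n) ≡ false → m ≢ n
≡ᵇfalse⇒≢ {m} m≢ᵇn refl with () ← trans (sym m≢ᵇn) (≡ᵇ-refl m)

finEq-refl : ∀ {k} (a : Fin k) → finEq a a ≡ true
finEq-refl a = ≡ᵇ-refl (toℕ a)

finEq-sym : ∀ {k} (a b : Fin k) → finEq a b ≡ finEq b a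
finEq-sym a b = ≡ᵇ-sym (toℕ a) (toℕ b)

finEq⇒≡ : ∀ {k} {a b : Fin k} → finEq a b ≡ true → a ≡ b
finEq⇒≡ {a = a} {b} e = toℕ-injective (≡ᵇ⇒≡ (toℕ a) (toℕ b) (Equivalence.from T-≡ e))

∨-swap-middle : ∀ a b c d → a ∨ b ∨ c ∨ d ≡ a ∨ c ∨ b ∨ d
∨-swap-middle = solve 4 (λ a b c d → a :+ (b :+ (c :+ d)) := a :+ (c :+ (b :+ d))) refl
  where open ∨-∧-Solver

suc≡ᵇ : ∀ c X → (suc c ≡ᵇ X) ≡ (c ≡ᵇ X ∸ 1) ∧ (0 <ᵇ X)
suc≡ᵇ c zero = sym (∧-zeroʳ (c ≡ᵇ 0))
suc≡ᵇ c (suc X) = sym (∧-identityʳ (c ≡ᵇ X))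

-- ℕtoℚ n normalises (+ n) / 1; fromℕ n is the same rational written in normal form, so arithmetic on it computes.
fromℕ : ℕ → ℚ
fromℕ n = mkℚ (ℤ.+ n) 0 (coprime-sym (1-coprimeTo n))

ℕtoℚ≡fromℕ : ∀ n → ℕtoℚ n ≡ fromℕ n
ℕtoℚ≡fromℕ n = ℚ.normalize-coprime (coprime-sym (1-coprimeTo n))

fromℕ-* : ∀ a b → fromℕ (a * b) ≡ fromℕ a *ℚ fromℕ b
fromℕ-* a b = trans (sym (ℕtoℚ≡fromℕ (a * b))) (cong (ℚ._/ 1) (ℤ.pos-* a b))

fromℕ-+ : ∀ a b → fromℕ (a + b) ≡ fromℕ a +ℚ fromℕ b
fromℕ-+ a b = trans (sym (ℕtoℚ≡fromℕ (a + b)))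
  (cong (ℚ._/ 1) (trans (ℤ.pos-+ a b) (sym (cong₂ ℤ._+_ (ℤ.*-identityʳ (ℤ.+ a)) (ℤ.*-identityʳ (ℤ.+ b))))))

fromℕ-mono-≤ : ∀ {a b} → a ≤ b → fromℕ a ≤ℚ fromℕ b
fromℕ-mono-≤ {a} {b} a≤b = ℚ.*≤* (subst₂ ℤ._≤_ (sym (ℤ.*-identityʳ (ℤ.+ a))) (sym (ℤ.*-identityʳ (ℤ.+ b))) (ℤ.+≤+ a≤b))

ℕtoℚ-* : ∀ a b → ℕtoℚ (a * b) ≡ ℕtoℚ a *ℚ ℕtoℚ b
ℕtoℚ-* a b rewrite ℕtoℚ≡fromℕ (a * b) | ℕtoℚ≡fromℕ a | ℕtoℚ≡fromℕ b = fromℕ-* a b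

ℕtoℚ-mono-≤ : ∀ {a b} → a ≤ b → ℕtoℚ a ≤ℚ ℕtoℚ b
ℕtoℚ-mono-≤ {a} {b} a≤b rewrite ℕtoℚ≡fromℕ a | ℕtoℚ≡fromℕ b = fromℕ-mono-≤ a≤b

ℕtoℚ-rescale : ∀ μx F X μx′ R → ℕtoℚ (X * μx) ≡ ℕtoℚ μx′ *ℚ R → ℕtoℚ (μx * (F * X)) ≡ ℕtoℚ (μx′ * F) *ℚ R
ℕtoℚ-rescale μx F X μx′ R Xμ≡ = begin
  ℕtoℚ (μx * (F * X))           ≡⟨ cong ℕtoℚ (ℕ*.x∙yz≈y∙zx μx F X) ⟩
  ℕtoℚ (F * (X * μx))           ≡⟨ ℕtoℚ-* F (X * μx) ⟩
  ℕtoℚ F *ℚ ℕtoℚ (X * μx)       ≡⟨ cong (ℕtoℚ F *ℚ_) Xμ≡ ⟩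
  ℕtoℚ F *ℚ (ℕtoℚ μx′ *ℚ R)     ≡⟨ ℚ*.x∙yz≈yx∙z (ℕtoℚ F) (ℕtoℚ μx′) R ⟩
  ℕtoℚ μx′ *ℚ ℕtoℚ F *ℚ R       ≡⟨ cong (_*ℚ R) (sym (ℕtoℚ-* μx′ F)) ⟩
  ℕtoℚ (μx′ * F) *ℚ R           ∎
  where open ≡-Reasoning

private
  module Field = +-*-Solver

-- c is the exact error d B ∸ A divided by B.
sandwich⇒shift : ∀ A B d b → A ≤ d * B → d * B ≤ A + b * B →
  Σ ℚ λ c → ∣ c ∣ ≤ℚ ℕtoℚ b × ℕtoℚ A ≡ ℕtoℚ B *ℚ (ℕtoℚ d -ℚ c)
sandwich⇒shift A zero d b A≤0 _ = 0ℚ , ℕtoℚ-mono-≤ {0} {b} z≤n , (begin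
  ℕtoℚ A                     ≡⟨ cong ℕtoℚ (n≤0⇒n≡0 {A} (subst (A ≤_) (*-zeroʳ d) A≤0)) ⟩
  0ℚ                         ≡⟨ sym (ℚ.*-zeroˡ (ℕtoℚ d -ℚ 0ℚ)) ⟩
  0ℚ *ℚ (ℕtoℚ d -ℚ 0ℚ)       ∎)
  where open ≡-Reasoning
sandwich⇒shift A B@(suc _) d b lo hi
  rewrite ℕtoℚ≡fromℕ A | ℕtoℚ≡fromℕ B | ℕtoℚ≡fromℕ d | ℕtoℚ≡fromℕ b = c , ∣c∣≤b , A≡
  where
  k = d * B ∸ A
  c = fromℕ k *ℚ ℚ.1/ fromℕ B

  cB≡k : c *ℚ fromℕ B ≡ fromℕ k
  cB≡k = trans (ℚ.*-assoc (fromℕ k) (ℚ.1/ fromℕ B) (fromℕ B))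
           (trans (cong (fromℕ k *ℚ_) (ℚ.*-inverseˡ (fromℕ B))) (ℚ.*-identityʳ (fromℕ k)))

  0≤c : 0ℚ ≤ℚ c
  0≤c = ℚ.*-cancelʳ-≤-pos (fromℕ B) (subst₂ _≤ℚ_ (sym (ℚ.*-zeroˡ (fromℕ B))) (sym cB≡k) (fromℕ-mono-≤ z≤n))

  c≤b : c ≤ℚ fromℕ b
  c≤b = ℚ.*-cancelʳ-≤-pos (fromℕ B)
    (subst₂ _≤ℚ_ (sym cB≡k) (fromℕ-* b B) (fromℕ-mono-≤ (m≤n+o⇒m∸n≤o (d * B) A hi)))

  ∣c∣≤b : ∣ c ∣ ≤ℚ fromℕ b
  ∣c∣≤b = subst (_≤ℚ fromℕ b) (sym (ℚ.0≤p⇒∣p∣≡p 0≤c)) c≤b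

  A≡ : fromℕ A ≡ fromℕ B *ℚ (fromℕ d -ℚ c)
  A≡ = begin
    fromℕ A                               ≡⟨ Field.solve 2 (λ a k → a Field.:= (a Field.:+ k) Field.:- k) refl (fromℕ A) (fromℕ k) ⟩
    (fromℕ A +ℚ fromℕ k) -ℚ fromℕ k       ≡⟨ cong₂ _-ℚ_ (trans (sym (fromℕ-+ A k)) (trans (cong fromℕ (m+[n∸m]≡n lo)) (fromℕ-* d B))) (sym cB≡k) ⟩
    fromℕ d *ℚ fromℕ B -ℚ c *ℚ fromℕ B    ≡⟨ Field.solve 3 (λ d b c → d Field.:* b Field.:- c Field.:* b Field.:= b Field.:* (d Field.:- c)) refl (fromℕ d) (fromℕ B) c ⟩
    fromℕ B *ℚ (fromℕ d -ℚ c)             ∎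
    where open ≡-Reasoning

-- Edge types

ascending : ∀ {r} → Fin r × Fin r → Bool
ascending (i , j) = toℕ i <ᵇ toℕ j

∈pairs⇒ascending : ∀ {r} {i j : Fin r} → (i , j) ∈ pairs r → toℕ i < toℕ j
∈pairs⇒ascending {r} {i} {j} ij∈ =
  <ᵇ⇒< (toℕ i) (toℕ j) (proj₂ (∈-filter⁻ (T? ∘ ascending) {xs = cartesianProduct (allFin r) (allFin r)} ij∈))

count-pairs : ∀ {r} (i j : Fin r) → toℕ i < toℕ j → count (λ p → finEq i (proj₁ p) ∧ finEq j (proj₂ p)) (pairs r) ≡ 1
count-pairs {r} i j i<j = begin
  count (λ p → finEq i (proj₁ p) ∧ finEq j (proj₂ p)) (pairs r)
    ≡⟨ count-filterᵇ ascending _ (cartesianProduct (allFin r) (allFin r)) ⟩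
  count (λ p → ascending p ∧ (finEq i (proj₁ p) ∧ finEq j (proj₂ p))) (cartesianProduct (allFin r) (allFin r))
    ≡⟨ ∑-cartesianProduct _ (allFin r) (allFin r) ⟩
  ∑ (λ a → ∑ (λ b → 𝟙 (ascending (a , b) ∧ (finEq i a ∧ finEq j b))) (allFin r)) (allFin r)
    ≡⟨ ∑-cong (allFin r) (λ {a} _ → trans (∑-cong (allFin r) (λ {b} _ → 𝟙-∧-rotate (ascending (a , b)) (finEq i a) (finEq j b)))
                                            (∑-*ˡ (𝟙 (finEq i a)) _ (allFin r))) ⟩
  ∑ (λ a → 𝟙 (finEq i a) * ∑ (λ b → 𝟙 (finEq j b) * 𝟙 (ascending (a , b))) (allFin r)) (allFin r)
    ≡⟨ ∑-allFin-finEq r i _ ⟩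
  ∑ (λ b → 𝟙 (finEq j b) * 𝟙 (ascending (i , b))) (allFin r)
    ≡⟨ ∑-allFin-finEq r j _ ⟩
  𝟙 (ascending (i , j))
    ≡⟨ cong 𝟙 (Equivalence.to T-≡ (<⇒<ᵇ i<j)) ⟩
  1 ∎
  where open ≡-Reasoning

EdgeType : ℕ → ℕ → Set
EdgeType ℓ r = Fin ℓ × Fin r × Fin r

module _ {ℓ r : ℕ} where

  edgeTypes : List (EdgeType ℓ r)
  edgeTypes = cartesianProduct (allFin ℓ) (pairs r)

  Ordered : EdgeType ℓ r → Set
  Ordered (_ , i , j) = toℕ i < toℕ j

  _⟨_⟩ : {X : Set} → (Fin ℓ → Fin r → Fin r → X) → EdgeType ℓ r → X
  x ⟨ m , i , j ⟩ = x m i j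

  sameType : EdgeType ℓ r → EdgeType ℓ r → Bool
  sameType (m , i , j) (m′ , i′ , j′) = finEq m m′ ∧ finEq i i′ ∧ finEq j j′

  sameType-refl : ∀ τ → sameType τ τ ≡ true
  sameType-refl (m , i , j) rewrite finEq-refl m | finEq-refl i | finEq-refl j = refl

  sameType-sym : ∀ τ τ′ → sameType τ τ′ ≡ sameType τ′ τ
  sameType-sym (m , i , j) (m′ , i′ , j′) rewrite finEq-sym m m′ | finEq-sym i i′ | finEq-sym j j′ = refl

  sameType⇒≡ : ∀ {τ τ′} → sameType τ τ′ ≡ true → τ ≡ τ′
  sameType⇒≡ {m , i , j} {m′ , i′ , j′} e with finEq m m′ in em | finEq i i′ in ei | finEq j j′ in ej | e
  ... | true | true | true | _ rewrite finEq⇒≡ {a = m} em | finEq⇒≡ {a = i} ei | finEq⇒≡ {a = j} ej = refl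

  infixl 6 _─_

  -- x − e_t, truncated at 0: it is only used where x ⟨ t ⟩ > 0 or under a factor 𝟙 (0 <ᵇ x ⟨ t ⟩).
  _─_ : Vector ℓ r → EdgeType ℓ r → Vector ℓ r
  (x ─ t) m i j = x m i j ∸ 𝟙 (sameType (m , i , j) t)

  ─-self : ∀ x s → (x ─ s) ⟨ s ⟩ ≡ x ⟨ s ⟩ ∸ 1
  ─-self x s = cong (λ b → x ⟨ s ⟩ ∸ 𝟙 b) (sameType-refl s)

  ─-comm : ∀ x s t m i j → (x ─ s ─ t) m i j ≡ (x ─ t ─ s) m i j
  ─-comm x s t m i j = begin
    x m i j ∸ 𝟙 (sameType τ s) ∸ 𝟙 (sameType τ t)   ≡⟨ ∸-+-assoc (x m i j) (𝟙 (sameType τ s)) (𝟙 (sameType τ t)) ⟩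
    x m i j ∸ (𝟙 (sameType τ s) + 𝟙 (sameType τ t)) ≡⟨ cong (x m i j ∸_) (+-comm (𝟙 (sameType τ s)) _) ⟩
    x m i j ∸ (𝟙 (sameType τ t) + 𝟙 (sameType τ s)) ≡⟨ sym (∸-+-assoc (x m i j) (𝟙 (sameType τ t)) (𝟙 (sameType τ s))) ⟩
    x m i j ∸ 𝟙 (sameType τ t) ∸ 𝟙 (sameType τ s)   ∎
    where
    open ≡-Reasoning
    τ = (m , i , j)

  count-sameType : ∀ t → Ordered t → count (sameType t) edgeTypes ≡ 1
  count-sameType (m , i , j) i<j = begin
    count (sameType (m , i , j)) edgeTypes
      ≡⟨ ∑-cartesianProduct _ (allFin ℓ) (pairs r) ⟩
    ∑ (λ m′ → ∑ (λ p → 𝟙 (finEq m m′ ∧ (finEq i (proj₁ p) ∧ finEq j (proj₂ p)))) (pairs r)) (allFin ℓ)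
      ≡⟨ ∑-cong (allFin ℓ) (λ {m′} _ → trans (∑-cong (pairs r) (λ _ → 𝟙-∧ (finEq m m′) _)) (∑-*ˡ (𝟙 (finEq m m′)) _ (pairs r))) ⟩
    ∑ (λ m′ → 𝟙 (finEq m m′) * count (λ p → finEq i (proj₁ p) ∧ finEq j (proj₂ p)) (pairs r)) (allFin ℓ)
      ≡⟨ ∑-allFin-finEq ℓ m _ ⟩
    count (λ p → finEq i (proj₁ p) ∧ finEq j (proj₂ p)) (pairs r)
      ≡⟨ count-pairs i j i<j ⟩
    1 ∎
    where open ≡-Reasoning

  count-sameTypeʳ : ∀ t → Ordered t → count (λ τ → sameType τ t) edgeTypes ≡ 1
  count-sameTypeʳ t o = trans (∑-cong edgeTypes (λ {τ} _ → cong 𝟙 (sameType-sym τ t))) (count-sameType t o)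

  Ordered⇒∈edgeTypes : ∀ {t} → Ordered t → t ∈ edgeTypes
  Ordered⇒∈edgeTypes {m , i , j} i<j = ∈-cartesianProduct⁺ (∈-allFin m) (∈-filter⁺ (T? ∘ ascending) (∈-cartesianProduct⁺ (∈-allFin i) (∈-allFin j)) (<⇒<ᵇ i<j))

  ∈edgeTypes⇒Ordered : ∀ {t} → t ∈ edgeTypes → Ordered t
  ∈edgeTypes⇒Ordered t∈ = ∈pairs⇒ascending (proj₂ (∈-cartesianProduct⁻ (allFin ℓ) (pairs r) t∈))

norm≡∑ : ∀ {ℓ r} (x : Vector ℓ r) → norm x ≡ ∑ (x ⟨_⟩) edgeTypes
norm≡∑ {ℓ} {r} x = trans (sum-concatMap _ (allFin ℓ)) (sym (∑-cartesianProduct (x ⟨_⟩) (allFin ℓ) (pairs r)))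

-- Double counting x-matchings

peel-one : ∀ X Y μx W → Y ≡ X ∸ 1 → 0 < X → (0 < Y → Y * μx ≡ W) → X * (𝟙 (0 <ᵇ X) * μx) ≡ 1 * μx + 𝟙 (0 <ᵇ Y) * W
peel-one (suc zero) .0 μx W refl _ _ = refl
peel-one (suc (suc X)) .(suc X) μx W refl _ h =
  cong (1 * μx +_) (trans (cong (suc X *_) (*-identityˡ μx)) (trans (h z<s) (sym (*-identityˡ W))))

module _ {ℓ r N : ℕ} where

  typeOf : Edge ℓ r N → EdgeType ℓ r
  typeOf (edge m i j _ _) = m , i , j

  isOfType : EdgeType ℓ r → Edge ℓ r N → Bool
  isOfType τ e = sameType τ (typeOf e)

  typeCount : EdgeType ℓ r → List (Edge ℓ r N) → ℕ
  typeCount τ M = length (filterᵇ (isOfType τ) M)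

  typeCount-∷ : ∀ τ a M → typeCount τ (a ∷ M) ≡ 𝟙 (isOfType τ a) + typeCount τ M
  typeCount-∷ τ a M with isOfType τ a
  ... | true = refl
  ... | false = refl

  hasTypeCounts : Vector ℓ r → List (Edge ℓ r N) → Bool
  hasTypeCounts x M = all (λ τ → typeCount τ M ≡ᵇ x ⟨ τ ⟩) edgeTypes

  isXMatching≡ : ∀ x M → isXMatching x M ≡ isMatching M ∧ hasTypeCounts x M
  isXMatching≡ x M = cong (isMatching M ∧_) (sym (all-cartesianProduct (λ τ → typeCount τ M ≡ᵇ x ⟨ τ ⟩) (allFin ℓ) (pairs r)))

  hasTypeCounts-∷ : ∀ x a M → Ordered (typeOf a) →
    hasTypeCounts x (a ∷ M) ≡ hasTypeCounts (x ─ typeOf a) M ∧ (0 <ᵇ x ⟨ typeOf a ⟩)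
  hasTypeCounts-∷ x a M o =
    all-extract (λ τ → sameType τ s) (λ τ → typeCount τ (a ∷ M) ≡ᵇ x ⟨ τ ⟩) (λ τ → typeCount τ M ≡ᵇ (x ─ s) ⟨ τ ⟩)
      (0 <ᵇ x ⟨ s ⟩) edgeTypes (count-sameTypeʳ s o) (λ {τ} → off {τ}) (λ {τ} → on {τ})
    where
    s = typeOf a
    off : ∀ {τ} → τ ∈ edgeTypes → sameType τ s ≡ false →
      (typeCount τ (a ∷ M) ≡ᵇ x ⟨ τ ⟩) ≡ (typeCount τ M ≡ᵇ (x ─ s) ⟨ τ ⟩)
    off {τ} _ τ≢s rewrite typeCount-∷ τ a M | τ≢s = refl
    on : ∀ {τ} → sameType τ s ≡ true →
      (typeCount τ (a ∷ M) ≡ᵇ x ⟨ τ ⟩) ≡ (typeCount τ M ≡ᵇ (x ─ s) ⟨ τ ⟩) ∧ (0 <ᵇ x ⟨ s ⟩)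
    on {τ} τ≡s with refl ← sameType⇒≡ {τ = τ} {τ′ = s} τ≡s rewrite typeCount-∷ s a M | sameType-refl s = suc≡ᵇ (typeCount s M) (x ⟨ s ⟩)

  shareVertex-refl : ∀ (e : Edge ℓ r N) → shareVertex e e ≡ true
  shareVertex-refl e rewrite finEq-refl (Edge.i e) | finEq-refl (Edge.a e) = refl

  vertexEq-sym : ∀ (u v : Vertex r N) → vertexEq u v ≡ vertexEq v u
  vertexEq-sym (i , a) (j , b) rewrite finEq-sym i j | finEq-sym a b = refl

  shareVertex-sym : ∀ (e f : Edge ℓ r N) → shareVertex e f ≡ shareVertex f e
  shareVertex-sym (edge _ i j a b) (edge _ i′ j′ a′ b′)
    rewrite vertexEq-sym (i , a) (i′ , a′) | vertexEq-sym (i , a) (j′ , b′)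
          | vertexEq-sym (j , b) (i′ , a′) | vertexEq-sym (j , b) (j′ , b′)
    = ∨-swap-middle (vertexEq (i′ , a′) (i , a)) (vertexEq (j′ , b′) (i , a)) (vertexEq (i′ , a′) (j , b)) (vertexEq (j′ , b′) (j , b))

  avoids : List (Edge ℓ r N) → Edge ℓ r N → Bool
  avoids F e = all (λ f → not (shareVertex f e)) F

  avoids-sym : ∀ M a → avoids M a ≡ all (λ e → not (shareVertex a e)) M
  avoids-sym M a = all-cong M (λ {f} _ → cong not (shareVertex-sym f a))

  isXMatchingAvoiding : Vector ℓ r → List (Edge ℓ r N) → List (Edge ℓ r N) → Bool
  isXMatchingAvoiding x F M = isXMatching x M ∧ all (avoids F) M

  isXMatchingAvoiding-∷ : ∀ x F a M → Ordered (typeOf a) →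
    isXMatchingAvoiding x F (a ∷ M) ≡ (avoids F a ∧ (0 <ᵇ x ⟨ typeOf a ⟩)) ∧ isXMatchingAvoiding (x ─ typeOf a) (a ∷ F) M
  isXMatchingAvoiding-∷ x F a M o = begin
    isXMatching x (a ∷ M) ∧ (avoids F a ∧ all (avoids F) M)
      ≡⟨ cong (_∧ (avoids F a ∧ all (avoids F) M)) (trans (isXMatching≡ x (a ∷ M)) (cong (isMatching (a ∷ M) ∧_) (hasTypeCounts-∷ x a M o))) ⟩
    ((apart ∧ isMatching M) ∧ (hasTypeCounts x′ M ∧ P)) ∧ (avoids F a ∧ all (avoids F) M)
      ≡⟨ regroup apart (isMatching M) (hasTypeCounts x′ M) P (avoids F a) (all (avoids F) M) ⟩
    (avoids F a ∧ P) ∧ ((isMatching M ∧ hasTypeCounts x′ M) ∧ (apart ∧ all (avoids F) M))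
      ≡⟨ cong₂ (λ u v → (avoids F a ∧ P) ∧ (u ∧ v)) (sym (isXMatching≡ x′ M)) (sym (all-∧ (λ e → not (shareVertex a e)) (avoids F) M)) ⟩
    (avoids F a ∧ P) ∧ isXMatchingAvoiding x′ (a ∷ F) M ∎
    where
    open ≡-Reasoning
    x′ = x ─ typeOf a
    apart = all (λ e → not (shareVertex a e)) M
    P = 0 <ᵇ x ⟨ typeOf a ⟩
    regroup : ∀ a i q p o k → ((a ∧ i) ∧ (q ∧ p)) ∧ (o ∧ k) ≡ (o ∧ p) ∧ ((i ∧ q) ∧ (a ∧ k))
    regroup = solve 6 (λ a i q p o k → ((a :* i) :* (q :* p)) :* (o :* k) := (o :* p) :* ((i :* q) :* (a :* k))) refl
      where open ∨-∧-Solver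

  -- Requiring the matchings to avoid a list F of edges chosen earlier is what lets the
  -- double counting below go through by induction on the edge list E.
  μAvoiding : List (Edge ℓ r N) → Vector ℓ r → List (Edge ℓ r N) → ℕ
  μAvoiding E x F = count (isXMatchingAvoiding x F) (sublists E)

  freeEdges : List (Edge ℓ r N) → List (Edge ℓ r N) → EdgeType ℓ r → List (Edge ℓ r N) → ℕ
  freeEdges E F t M = count (λ e → isOfType t e ∧ (avoids M e ∧ avoids F e)) E

  extensions : List (Edge ℓ r N) → Vector ℓ r → List (Edge ℓ r N) → EdgeType ℓ r → ℕ
  extensions E x F t = ∑ (λ M → 𝟙 (isXMatchingAvoiding x F M) * freeEdges E F t M) (sublists E)

  μAvoiding-∷ : ∀ a E x F → Ordered (typeOf a) →
    μAvoiding (a ∷ E) x F ≡ μAvoiding E x F + 𝟙 (avoids F a ∧ (0 <ᵇ x ⟨ typeOf a ⟩)) * μAvoiding E (x ─ typeOf a) (a ∷ F)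
  μAvoiding-∷ a E x F o = begin
    count (isXMatchingAvoiding x F) (sublists E ++ map (a ∷_) (sublists E))
      ≡⟨ ∑-++ _ (sublists E) (map (a ∷_) (sublists E)) ⟩
    μAvoiding E x F + count (isXMatchingAvoiding x F) (map (a ∷_) (sublists E))
      ≡⟨ cong (μAvoiding E x F +_) (∑-map _ (a ∷_) (sublists E)) ⟩
    μAvoiding E x F + ∑ (λ M → 𝟙 (isXMatchingAvoiding x F (a ∷ M))) (sublists E)
      ≡⟨ cong (μAvoiding E x F +_) (∑-cong (sublists E) (λ {M} _ →
           trans (cong 𝟙 (isXMatchingAvoiding-∷ x F a M o)) (𝟙-∧ G (isXMatchingAvoiding (x ─ typeOf a) (a ∷ F) M)))) ⟩
    μAvoiding E x F + ∑ (λ M → 𝟙 G * 𝟙 (isXMatchingAvoiding (x ─ typeOf a) (a ∷ F) M)) (sublists E)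
      ≡⟨ cong (μAvoiding E x F +_) (∑-*ˡ (𝟙 G) _ (sublists E)) ⟩
    μAvoiding E x F + 𝟙 G * μAvoiding E (x ─ typeOf a) (a ∷ F) ∎
    where
    open ≡-Reasoning
    G = avoids F a ∧ (0 <ᵇ x ⟨ typeOf a ⟩)

  freeEdges-∷-∷ : ∀ a E F t M → freeEdges (a ∷ E) F t (a ∷ M) ≡ freeEdges E (a ∷ F) t M
  freeEdges-∷-∷ a E F t M rewrite shareVertex-refl a | ∧-zeroʳ (isOfType t a) =
    ∑-cong E (λ {e} _ → cong (λ b → 𝟙 (isOfType t e ∧ b)) (∧-swapˡ (not (shareVertex a e)) (avoids M e) (avoids F e)))
    where
    ∧-swapˡ : ∀ a b c → (a ∧ b) ∧ c ≡ b ∧ (a ∧ c)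
    ∧-swapˡ = solve 3 (λ a b c → (a :* b) :* c := b :* (a :* c)) refl
      where open ∨-∧-Solver

  𝟙-avoids-swap : ∀ x F a M t →
    𝟙 (isXMatchingAvoiding x F M) * 𝟙 (isOfType t a ∧ (avoids M a ∧ avoids F a))
      ≡ 𝟙 (isOfType t a ∧ avoids F a) * 𝟙 (isXMatchingAvoiding x (a ∷ F) M)
  𝟙-avoids-swap x F a M t = begin
    𝟙 (isXMatchingAvoiding x F M) * 𝟙 (h ∧ (avoids M a ∧ o))
      ≡⟨ sym (𝟙-∧ (isXMatchingAvoiding x F M) _) ⟩
    𝟙 ((isXMatching x M ∧ all (avoids F) M) ∧ (h ∧ (avoids M a ∧ o)))
      ≡⟨ cong (λ b → 𝟙 ((isXMatching x M ∧ all (avoids F) M) ∧ (h ∧ (b ∧ o)))) (avoids-sym M a) ⟩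
    𝟙 ((isXMatching x M ∧ all (avoids F) M) ∧ (h ∧ (apart ∧ o)))
      ≡⟨ cong 𝟙 (regroup (isXMatching x M) (all (avoids F) M) h apart o) ⟩
    𝟙 ((h ∧ o) ∧ (isXMatching x M ∧ (apart ∧ all (avoids F) M)))
      ≡⟨ cong (λ b → 𝟙 ((h ∧ o) ∧ (isXMatching x M ∧ b))) (sym (all-∧ (λ e → not (shareVertex a e)) (avoids F) M)) ⟩
    𝟙 ((h ∧ o) ∧ isXMatchingAvoiding x (a ∷ F) M)
      ≡⟨ 𝟙-∧ (h ∧ o) _ ⟩
    𝟙 (h ∧ o) * 𝟙 (isXMatchingAvoiding x (a ∷ F) M) ∎
    where
    open ≡-Reasoning
    h = isOfType t a
    o = avoids F a
    apart = all (λ e → not (shareVertex a e)) M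
    regroup : ∀ m k h a o → (m ∧ k) ∧ (h ∧ (a ∧ o)) ≡ (h ∧ o) ∧ (m ∧ (a ∧ k))
    regroup = solve 5 (λ m k h a o → (m :* k) :* (h :* (a :* o)) := (h :* o) :* (m :* (a :* k))) refl
      where open ∨-∧-Solver

  extensions-∷ : ∀ a E x F t → Ordered (typeOf a) →
    extensions (a ∷ E) x F t ≡
      extensions E x F t + 𝟙 (isOfType t a ∧ avoids F a) * μAvoiding E x (a ∷ F)
      + 𝟙 (avoids F a ∧ (0 <ᵇ x ⟨ typeOf a ⟩)) * extensions E (x ─ typeOf a) (a ∷ F) t
  extensions-∷ a E x F t o = trans (∑-++ f (sublists E) (map (a ∷_) (sublists E))) (cong₂ _+_ without-a with-a)
    where
    f : List (Edge ℓ r N) → ℕ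
    f M = 𝟙 (isXMatchingAvoiding x F M) * freeEdges (a ∷ E) F t M
    G = avoids F a ∧ (0 <ᵇ x ⟨ typeOf a ⟩)

    without-a : ∑ f (sublists E) ≡ extensions E x F t + 𝟙 (isOfType t a ∧ avoids F a) * μAvoiding E x (a ∷ F)
    without-a = begin
      ∑ f (sublists E)
        ≡⟨ ∑-cong (sublists E) (λ {M} _ → trans (*-distribˡ-+ (𝟙 (isXMatchingAvoiding x F M)) _ (freeEdges E F t M))
                                               (+-comm _ (𝟙 (isXMatchingAvoiding x F M) * freeEdges E F t M))) ⟩
      ∑ (λ M → 𝟙 (isXMatchingAvoiding x F M) * freeEdges E F t M
             + 𝟙 (isXMatchingAvoiding x F M) * 𝟙 (isOfType t a ∧ (avoids M a ∧ avoids F a))) (sublists E)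
        ≡⟨ ∑-+ _ _ (sublists E) ⟩
      extensions E x F t + ∑ (λ M → 𝟙 (isXMatchingAvoiding x F M) * 𝟙 (isOfType t a ∧ (avoids M a ∧ avoids F a))) (sublists E)
        ≡⟨ cong (extensions E x F t +_) (trans (∑-cong (sublists E) (λ {M} _ → 𝟙-avoids-swap x F a M t))
                                                      (∑-*ˡ (𝟙 (isOfType t a ∧ avoids F a)) (𝟙 ∘ isXMatchingAvoiding x (a ∷ F)) (sublists E))) ⟩
      extensions E x F t + 𝟙 (isOfType t a ∧ avoids F a) * μAvoiding E x (a ∷ F) ∎
      where open ≡-Reasoning

    with-a : ∑ f (map (a ∷_) (sublists E)) ≡ 𝟙 G * extensions E (x ─ typeOf a) (a ∷ F) t
    with-a = begin
      ∑ f (map (a ∷_) (sublists E))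
        ≡⟨ ∑-map f (a ∷_) (sublists E) ⟩
      ∑ (λ M → 𝟙 (isXMatchingAvoiding x F (a ∷ M)) * freeEdges (a ∷ E) F t (a ∷ M)) (sublists E)
        ≡⟨ ∑-cong (sublists E) (λ {M} _ → trans
             (cong₂ _*_ (trans (cong 𝟙 (isXMatchingAvoiding-∷ x F a M o)) (𝟙-∧ G _)) (freeEdges-∷-∷ a E F t M))
             (*-assoc (𝟙 G) _ _)) ⟩
      ∑ (λ M → 𝟙 G * (𝟙 (isXMatchingAvoiding (x ─ typeOf a) (a ∷ F) M) * freeEdges E (a ∷ F) t M)) (sublists E)
        ≡⟨ ∑-*ˡ (𝟙 G) (λ M → 𝟙 (isXMatchingAvoiding (x ─ typeOf a) (a ∷ F) M) * freeEdges E (a ∷ F) t M) (sublists E) ⟩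
      𝟙 G * extensions E (x ─ typeOf a) (a ∷ F) t ∎
      where open ≡-Reasoning

  isXMatching-cong : ∀ {x y : Vector ℓ r} → (∀ m i j → x m i j ≡ y m i j) → ∀ M → isXMatching x M ≡ isXMatching y M
  isXMatching-cong {x} {y} x≗y M = begin
    isXMatching x M                      ≡⟨ isXMatching≡ x M ⟩
    isMatching M ∧ hasTypeCounts x M     ≡⟨ cong (isMatching M ∧_) (all-cong edgeTypes (λ {(m , i , j)} _ → cong (typeCount (m , i , j) M ≡ᵇ_) (x≗y m i j))) ⟩
    isMatching M ∧ hasTypeCounts y M     ≡⟨ sym (isXMatching≡ y M) ⟩
    isXMatching y M                      ∎
    where open ≡-Reasoning

  extensions-cong : ∀ E {x y : Vector ℓ r} F t → (∀ m i j → x m i j ≡ y m i j) → extensions E x F t ≡ extensions E y F t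
  extensions-cong E F t x≗y = ∑-cong (sublists E) (λ {M} _ → cong (λ b → 𝟙 (b ∧ all (avoids F) M) * freeEdges E F t M) (isXMatching-cong x≗y M))

  hasTypeCounts-[] : ∀ x t → Ordered t → 0 < x ⟨ t ⟩ → hasTypeCounts x [] ≡ false
  hasTypeCounts-[] x t o x>0 = ∈-false⇒all-false (λ τ → 0 ≡ᵇ x ⟨ τ ⟩) (Ordered⇒∈edgeTypes o) (0≢ᵇ x>0)
    where
    0≢ᵇ : ∀ {n} → 0 < n → (0 ≡ᵇ n) ≡ false
    0≢ᵇ z<s = refl

  DoubleCounting : List (Edge ℓ r N) → Set
  DoubleCounting E = ∀ x F t → Ordered t → 0 < x ⟨ t ⟩ → x ⟨ t ⟩ * μAvoiding E x F ≡ extensions E (x ─ t) F t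

  double-counting-new-edge : ∀ {E} → DoubleCounting E → ∀ a → Ordered (typeOf a) → ∀ x F t → Ordered t → 0 < x ⟨ t ⟩ →
    x ⟨ t ⟩ * (𝟙 (avoids F a ∧ (0 <ᵇ x ⟨ typeOf a ⟩)) * μAvoiding E (x ─ typeOf a) (a ∷ F))
      ≡ 𝟙 (isOfType t a ∧ avoids F a) * μAvoiding E (x ─ t) (a ∷ F)
        + 𝟙 (avoids F a ∧ (0 <ᵇ (x ─ t) ⟨ typeOf a ⟩)) * extensions E (x ─ t ─ typeOf a) (a ∷ F) t
  double-counting-new-edge {E} IH a oa x F t ot x>0 with avoids F a | isOfType t a in t≟a
  ... | false | true = *-zeroʳ (x ⟨ t ⟩)
  ... | false | false = *-zeroʳ (x ⟨ t ⟩)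
  -- a has type t: it is either the marked edge itself or one of the x ⟨ t ⟩ − 1 others.
  ... | true | true with refl ← sameType⇒≡ {τ = t} {τ′ = typeOf a} t≟a =
    peel-one (x ⟨ t ⟩) ((x ─ t) ⟨ t ⟩) _ _ (─-self x t) x>0 (IH (x ─ t) (a ∷ F) t ot)
  ... | true | false = begin
    X * (𝟙 (0 <ᵇ x ⟨ s ⟩) * μAvoiding E (x ─ s) (a ∷ F))   ≡⟨ ℕ*.x∙yz≈y∙xz X (𝟙 (0 <ᵇ x ⟨ s ⟩)) _ ⟩
    𝟙 (0 <ᵇ x ⟨ s ⟩) * (X * μAvoiding E (x ─ s) (a ∷ F))   ≡⟨ cong₂ (λ b n → 𝟙 (0 <ᵇ x ⟨ s ⟩ ∸ 𝟙 b) * n) (sym s≢t) (cong (_* μAvoiding E (x ─ s) (a ∷ F)) (sym t-count)) ⟩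
    𝟙 (0 <ᵇ (x ─ t) ⟨ s ⟩) * ((x ─ s) ⟨ t ⟩ * μAvoiding E (x ─ s) (a ∷ F))
                                                           ≡⟨ cong (𝟙 (0 <ᵇ (x ─ t) ⟨ s ⟩) *_) (IH (x ─ s) (a ∷ F) t ot (subst (0 <_) (sym t-count) x>0)) ⟩
    𝟙 (0 <ᵇ (x ─ t) ⟨ s ⟩) * extensions E (x ─ s ─ t) (a ∷ F) t
                                                           ≡⟨ cong (𝟙 (0 <ᵇ (x ─ t) ⟨ s ⟩) *_) (extensions-cong E (a ∷ F) t (─-comm x s t)) ⟩
    𝟙 (0 <ᵇ (x ─ t) ⟨ s ⟩) * extensions E (x ─ t ─ s) (a ∷ F) t ∎
    where
    open ≡-Reasoning
    s = typeOf a
    X = x ⟨ t ⟩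
    s≢t : sameType s t ≡ false
    s≢t = trans (sameType-sym s t) t≟a
    t-count : (x ─ s) ⟨ t ⟩ ≡ X
    t-count = cong (λ b → X ∸ 𝟙 b) t≟a

  double-counting : ∀ E → All (Ordered ∘ typeOf) E → DoubleCounting E
  double-counting [] _ x F t ot x>0 rewrite isXMatching≡ x [] | hasTypeCounts-[] x t ot x>0 =
    trans (*-zeroʳ (x ⟨ t ⟩)) (sym (trans (+-identityʳ _) (*-zeroʳ (𝟙 (isXMatchingAvoiding (x ─ t) F [])))))
  double-counting (a ∷ E) (oa ∷ oE) x F t ot x>0 = begin
    X * μAvoiding (a ∷ E) x F
      ≡⟨ cong (X *_) (μAvoiding-∷ a E x F oa) ⟩
    X * (μAvoiding E x F + 𝟙 (avoids F a ∧ (0 <ᵇ x ⟨ s ⟩)) * μAvoiding E (x ─ s) (a ∷ F))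
      ≡⟨ *-distribˡ-+ X _ _ ⟩
    X * μAvoiding E x F + X * (𝟙 (avoids F a ∧ (0 <ᵇ x ⟨ s ⟩)) * μAvoiding E (x ─ s) (a ∷ F))
      ≡⟨ cong₂ _+_ (IH x F t ot x>0) (double-counting-new-edge {E} IH a oa x F t ot x>0) ⟩
    extensions E (x ─ t) F t + (𝟙 (isOfType t a ∧ avoids F a) * μAvoiding E (x ─ t) (a ∷ F)
      + 𝟙 (avoids F a ∧ (0 <ᵇ (x ─ t) ⟨ s ⟩)) * extensions E (x ─ t ─ s) (a ∷ F) t)
      ≡⟨ sym (+-assoc (extensions E (x ─ t) F t) _ _) ⟩
    extensions E (x ─ t) F t + 𝟙 (isOfType t a ∧ avoids F a) * μAvoiding E (x ─ t) (a ∷ F)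
      + 𝟙 (avoids F a ∧ (0 <ᵇ (x ─ t) ⟨ s ⟩)) * extensions E (x ─ t ─ s) (a ∷ F) t
      ≡⟨ sym (extensions-∷ a E (x ─ t) F t oa) ⟩
    extensions (a ∷ E) (x ─ t) F t ∎
    where
    open ≡-Reasoning
    IH = double-counting E oE
    s = typeOf a
    X = x ⟨ t ⟩

  length-xMatching : ∀ (x : Vector ℓ r) (M : List (Edge ℓ r N)) → isXMatching x M ≡ true → All (Ordered ∘ typeOf) M →
    length M ≡ norm x
  length-xMatching x M xM oM = begin
    length M
      ≡⟨ sym (trans (∑-const 1 M) (*-identityˡ (length M))) ⟩
    ∑ (λ _ → 1) M
      ≡⟨ sym (∑-cong M (λ {e} e∈ → count-sameTypeʳ (typeOf e) (All.lookup oM e∈))) ⟩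
    ∑ (λ e → count (λ τ → sameType τ (typeOf e)) edgeTypes) M
      ≡⟨ ∑-swap (λ e τ → 𝟙 (sameType τ (typeOf e))) M edgeTypes ⟩
    ∑ (λ τ → count (isOfType τ) M) edgeTypes
      ≡⟨ ∑-cong edgeTypes (λ {τ} τ∈ → trans (sym (length-filterᵇ (isOfType τ) M)) (≡ᵇ⇒≡ _ _ (Equivalence.from T-≡ (all-true⇒∈ _ counts τ∈)))) ⟩
    ∑ (x ⟨_⟩) edgeTypes
      ≡⟨ sym (norm≡∑ x) ⟩
    norm x ∎
    where
    open ≡-Reasoning
    counts : hasTypeCounts x M ≡ true
    counts = ∧-conicalʳ (isMatching M) (hasTypeCounts x M) (trans (sym (isXMatching≡ x M)) xM)

  freeEdges≤ : ∀ E t (M : List (Edge ℓ r N)) → freeEdges E [] t M ≤ count (isOfType t) E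
  freeEdges≤ E t M = ∑-mono-≤ E (λ {e} _ → 𝟙-∧-≤ (isOfType t e) (avoids M e ∧ true))
    where
    𝟙-∧-≤ : ∀ a b → 𝟙 (a ∧ b) ≤ 𝟙 a
    𝟙-∧-≤ false b = z≤n
    𝟙-∧-≤ true b = 𝟙≤1 b

  count≤freeEdges+blocked : ∀ E t (M : List (Edge ℓ r N)) →
    count (isOfType t) E ≤ freeEdges E [] t M + ∑ (λ f → count (λ e → isOfType t e ∧ shareVertex f e) E) M
  count≤freeEdges+blocked E t M = begin
    count (isOfType t) E
      ≤⟨ ∑-mono-≤ E (λ {e} _ → union-bound (isOfType t e) (λ f → shareVertex f e) M) ⟩
    ∑ (λ e → 𝟙 (isOfType t e ∧ avoids M e) + count (λ f → isOfType t e ∧ shareVertex f e) M) E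
      ≡⟨ ∑-+ _ _ E ⟩
    count (λ e → isOfType t e ∧ avoids M e) E + ∑ (λ e → count (λ f → isOfType t e ∧ shareVertex f e) M) E
      ≡⟨ cong₂ _+_ (∑-cong E (λ {e} _ → cong (λ b → 𝟙 (isOfType t e ∧ b)) (sym (∧-identityʳ (avoids M e)))))
                   (∑-swap (λ e f → 𝟙 (isOfType t e ∧ shareVertex f e)) E M) ⟩
    freeEdges E [] t M + ∑ (λ f → count (λ e → isOfType t e ∧ shareVertex f e) E) M ∎
    where open ≤-Reasoning

  extensions≤ : ∀ E x t → extensions E x [] t ≤ count (isOfType t) E * μAvoiding E x []
  extensions≤ E x t = begin
    extensions E x [] t
      ≤⟨ ∑-mono-≤ (sublists E) (λ {M} _ → *-monoʳ-≤ (𝟙 (isXMatchingAvoiding x [] M)) (freeEdges≤ E t M)) ⟩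
    ∑ (λ M → 𝟙 (isXMatchingAvoiding x [] M) * count (isOfType t) E) (sublists E)
      ≡⟨ ∑-*ʳ (count (isOfType t) E) _ (sublists E) ⟩
    μAvoiding E x [] * count (isOfType t) E
      ≡⟨ *-comm (μAvoiding E x []) _ ⟩
    count (isOfType t) E * μAvoiding E x [] ∎
    where open ≤-Reasoning

  μAvoiding-zero : ∀ (x : Vector ℓ r) → (∀ {τ} → τ ∈ edgeTypes → x ⟨ τ ⟩ ≡ 0) →
    ∀ (E : List (Edge ℓ r N)) → All (Ordered ∘ typeOf) E → ∀ F → μAvoiding E x F ≡ 1
  μAvoiding-zero x x≡0 [] _ F =
    cong (λ b → 𝟙 (b ∧ true) + 0) (trans (isXMatching≡ x []) (∀∈-true⇒all-true (λ τ → 0 ≡ᵇ x ⟨ τ ⟩) edgeTypes (λ τ∈ → cong (0 ≡ᵇ_) (x≡0 τ∈))))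
  μAvoiding-zero x x≡0 (a ∷ E) (oa ∷ oE) F = begin
    μAvoiding (a ∷ E) x F
      ≡⟨ μAvoiding-∷ a E x F oa ⟩
    μAvoiding E x F + 𝟙 (avoids F a ∧ (0 <ᵇ x ⟨ typeOf a ⟩)) * μAvoiding E (x ─ typeOf a) (a ∷ F)
      ≡⟨ cong (λ n → μAvoiding E x F + 𝟙 (avoids F a ∧ (0 <ᵇ n)) * μAvoiding E (x ─ typeOf a) (a ∷ F)) (x≡0 (Ordered⇒∈edgeTypes oa)) ⟩
    μAvoiding E x F + 𝟙 (avoids F a ∧ false) * μAvoiding E (x ─ typeOf a) (a ∷ F)
      ≡⟨ cong (λ b → μAvoiding E x F + 𝟙 b * μAvoiding E (x ─ typeOf a) (a ∷ F)) (∧-zeroʳ (avoids F a)) ⟩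
    μAvoiding E x F + 0
      ≡⟨ trans (+-identityʳ _) (μAvoiding-zero x x≡0 E oE F) ⟩
    1 ∎
    where open ≡-Reasoning

-- Shifted powers

Shifts : ℕ → ℕ → Set
Shifts ℓ r = Fin ℓ → Fin r → Fin r → ℕ → ℚ

BoundedBy : ∀ {ℓ r} → ℚ → Vector ℓ r → Shifts ℓ r → Set
BoundedBy {r = r} B x c = ∀ m (i j : Fin r) → toℕ i < toℕ j → ∀ k → k < x m i j → ∣ c m i j k ∣ ≤ℚ B

module _ {ℓ r : ℕ} where

  factVec≡∏ : ∀ (x : Vector ℓ r) → factVec x ≡ ∏ (λ τ → x ⟨ τ ⟩ !) edgeTypes
  factVec≡∏ x = trans (product-concatMap _ (allFin ℓ)) (sym (∏-cartesianProduct (λ τ → x ⟨ τ ⟩ !) (allFin ℓ) (pairs r)))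

  shiftedBlock : Vector ℓ r → Vector ℓ r → Shifts ℓ r → EdgeType ℓ r → ℚ
  shiftedBlock d x c τ = ∏ℚ (λ k → ℕtoℚ (d ⟨ τ ⟩) -ℚ (c ⟨ τ ⟩) k) (upTo (x ⟨ τ ⟩))

  shiftedPower≡∏ : ∀ d x c → shiftedPower d x c ≡ ∏ℚ (shiftedBlock d x c) edgeTypes
  shiftedPower≡∏ d x c = begin
    shiftedPower d x c
      ≡⟨ prodℚ-concatMap _ (allFin ℓ) ⟩
    ∏ℚ (λ m → prodℚ (concatMap (λ ij → map (λ k → ℕtoℚ (d ⟨ m , ij ⟩) -ℚ (c ⟨ m , ij ⟩) k) (upTo (x ⟨ m , ij ⟩))) (pairs r))) (allFin ℓ)
      ≡⟨ ∏ℚ-cong (allFin ℓ) (λ _ → prodℚ-concatMap _ (pairs r)) ⟩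
    ∏ℚ (λ m → ∏ℚ (λ ij → shiftedBlock d x c (m , ij)) (pairs r)) (allFin ℓ)
      ≡⟨ sym (∏ℚ-cartesianProduct (shiftedBlock d x c) (allFin ℓ) (pairs r)) ⟩
    ∏ℚ (shiftedBlock d x c) edgeTypes ∎
    where open ≡-Reasoning

  setShift : Shifts ℓ r → EdgeType ℓ r → ℕ → ℚ → Shifts ℓ r
  setShift c s k q m i j k′ = if sameType (m , i , j) s ∧ (k′ ≡ᵇ k) then q else c m i j k′

  module _ (x : Vector ℓ r) (s : EdgeType ℓ r) (o : Ordered s) (x>0 : 0 < x ⟨ s ⟩) where

    private
      Y = (x ─ s) ⟨ s ⟩

      X≡1+Y : x ⟨ s ⟩ ≡ suc Y
      X≡1+Y = trans (sym (m∸n+n≡m x>0)) (trans (+-comm _ 1) (cong suc (sym (─-self x s))))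

    norm-─ : norm x ≡ suc (norm (x ─ s))
    norm-─ = begin
      norm x                           ≡⟨ norm≡∑ x ⟩
      ∑ (x ⟨_⟩) edgeTypes              ≡⟨ ∑-extract (λ τ → sameType τ s) (x ⟨_⟩) ((x ─ s) ⟨_⟩) 1 edgeTypes (count-sameTypeʳ s o) off on ⟩
      ∑ ((x ─ s) ⟨_⟩) edgeTypes + 1    ≡⟨ cong (_+ 1) (sym (norm≡∑ (x ─ s))) ⟩
      norm (x ─ s) + 1                 ≡⟨ +-comm (norm (x ─ s)) 1 ⟩
      suc (norm (x ─ s))               ∎
      where
      open ≡-Reasoning
      off : ∀ {τ} → τ ∈ edgeTypes → sameType τ s ≡ false → x ⟨ τ ⟩ ≡ (x ─ s) ⟨ τ ⟩
      off {τ} _ τ≢s = cong (λ b → x ⟨ τ ⟩ ∸ 𝟙 b) (sym τ≢s)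
      on : ∀ {τ} → sameType τ s ≡ true → x ⟨ τ ⟩ ≡ (x ─ s) ⟨ τ ⟩ + 1
      on {τ} τ≡s with refl ← sameType⇒≡ {τ = τ} {τ′ = s} τ≡s = trans X≡1+Y (+-comm 1 Y)

    factVec-─ : factVec x ≡ factVec (x ─ s) * x ⟨ s ⟩
    factVec-─ = begin
      factVec x                                  ≡⟨ factVec≡∏ x ⟩
      ∏ (λ τ → x ⟨ τ ⟩ !) edgeTypes              ≡⟨ ∏-extract (λ τ → sameType τ s) (λ τ → x ⟨ τ ⟩ !) (λ τ → (x ─ s) ⟨ τ ⟩ !) (x ⟨ s ⟩)
                                                               edgeTypes (count-sameTypeʳ s o) off on ⟩
      ∏ (λ τ → (x ─ s) ⟨ τ ⟩ !) edgeTypes * x ⟨ s ⟩ ≡⟨ cong (_* x ⟨ s ⟩) (sym (factVec≡∏ (x ─ s))) ⟩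
      factVec (x ─ s) * x ⟨ s ⟩                  ∎
      where
      open ≡-Reasoning
      off : ∀ {τ} → τ ∈ edgeTypes → sameType τ s ≡ false → x ⟨ τ ⟩ ! ≡ (x ─ s) ⟨ τ ⟩ !
      off {τ} _ τ≢s = cong (λ b → (x ⟨ τ ⟩ ∸ 𝟙 b) !) (sym τ≢s)
      on : ∀ {τ} → sameType τ s ≡ true → x ⟨ τ ⟩ ! ≡ (x ─ s) ⟨ τ ⟩ ! * x ⟨ s ⟩
      on {τ} τ≡s with refl ← sameType⇒≡ {τ = τ} {τ′ = s} τ≡s =
        trans (cong _! X≡1+Y) (trans (*-comm (suc Y) (Y !)) (cong (Y ! *_) (sym X≡1+Y)))

    shiftedPower-setShift : ∀ d c q → shiftedPower d x (setShift c s Y q) ≡ shiftedPower d (x ─ s) c *ℚ (ℕtoℚ (d ⟨ s ⟩) -ℚ q)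
    shiftedPower-setShift d c q = begin
      shiftedPower d x c′                            ≡⟨ shiftedPower≡∏ d x c′ ⟩
      ∏ℚ (shiftedBlock d x c′) edgeTypes             ≡⟨ ∏ℚ-extract (λ τ → sameType τ s) (shiftedBlock d x c′) (shiftedBlock d (x ─ s) c) R
                                                                   edgeTypes (count-sameTypeʳ s o) off on ⟩
      ∏ℚ (shiftedBlock d (x ─ s) c) edgeTypes *ℚ R   ≡⟨ cong (_*ℚ R) (sym (shiftedPower≡∏ d (x ─ s) c)) ⟩
      shiftedPower d (x ─ s) c *ℚ R                  ∎
      where
      open ≡-Reasoning
      c′ = setShift c s Y q
      R = ℕtoℚ (d ⟨ s ⟩) -ℚ q
      off : ∀ {τ} → τ ∈ edgeTypes → sameType τ s ≡ false → shiftedBlock d x c′ τ ≡ shiftedBlock d (x ─ s) c τ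
      off {τ} _ τ≢s = trans (cong (λ b → ∏ℚ (λ k → ℕtoℚ (d ⟨ τ ⟩) -ℚ (if b ∧ (k ≡ᵇ Y) then q else (c ⟨ τ ⟩) k)) (upTo (x ⟨ τ ⟩))) τ≢s)
                            (cong (λ b → ∏ℚ (λ k → ℕtoℚ (d ⟨ τ ⟩) -ℚ (c ⟨ τ ⟩) k) (upTo (x ⟨ τ ⟩ ∸ 𝟙 b))) (sym τ≢s))
      on : ∀ {τ} → sameType τ s ≡ true → shiftedBlock d x c′ τ ≡ shiftedBlock d (x ─ s) c τ *ℚ R
      on {τ} τ≡s with refl ← sameType⇒≡ {τ = τ} {τ′ = s} τ≡s = begin
        ∏ℚ shifted′ (upTo (x ⟨ s ⟩))                 ≡⟨ cong (∏ℚ shifted′ ∘ upTo) X≡1+Y ⟩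
        ∏ℚ shifted′ (upTo (suc Y))                   ≡⟨ ∏ℚ-upTo-suc shifted′ Y ⟩
        ∏ℚ shifted′ (upTo Y) *ℚ shifted′ Y           ≡⟨ cong₂ _*ℚ_ (∏ℚ-cong (upTo Y) (λ k∈ → below (∈-upTo⁻ k∈))) last ⟩
        ∏ℚ shifted (upTo Y) *ℚ R                     ∎
        where
        shifted′ shifted : ℕ → ℚ
        shifted′ k = ℕtoℚ (d ⟨ s ⟩) -ℚ (c′ ⟨ s ⟩) k
        shifted k = ℕtoℚ (d ⟨ s ⟩) -ℚ (c ⟨ s ⟩) k
        below : ∀ {k} → k < Y → shifted′ k ≡ shifted k
        below {k} k<Y = cong (λ b → ℕtoℚ (d ⟨ s ⟩) -ℚ (if b then q else (c ⟨ s ⟩) k))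
                             (trans (cong (sameType s s ∧_) (<⇒≡ᵇfalse k<Y)) (∧-zeroʳ (sameType s s)))
        last : shifted′ Y ≡ R
        last = cong (λ b → ℕtoℚ (d ⟨ s ⟩) -ℚ (if b then q else (c ⟨ s ⟩) Y)) (cong₂ _∧_ (sameType-refl s) (≡ᵇ-refl Y))

    setShift-bounded : ∀ {B} c q → ∣ q ∣ ≤ℚ B → BoundedBy B (x ─ s) c → BoundedBy B x (setShift c s Y q)
    setShift-bounded c q q≤B c≤B m i j i<j k k<x with sameType (m , i , j) s in τ≟s | k ≡ᵇ Y in k≟Y
    ... | true | true = q≤B
    ... | false | _ = c≤B m i j i<j k (subst (k <_) (cong (λ b → x m i j ∸ 𝟙 b) (sym τ≟s)) k<x)
    ... | true | false with refl ← sameType⇒≡ {τ = m , i , j} {τ′ = s} τ≟s =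
      c≤B m i j i<j k (≤∧≢⇒< (s≤s⁻¹ (subst (k <_) X≡1+Y k<x)) (≡ᵇfalse⇒≢ k≟Y))

-- The graphs D_m

module _ {ℓ r N : ℕ} (Ds : Fin ℓ → Graph r N) where

  private
    NN : List (Fin N × Fin N)
    NN = cartesianProduct (allFin N) (allFin N)

    E : List (Edge ℓ r N)
    E = allEdges Ds

  edgeOf : EdgeType ℓ r → Fin N × Fin N → Edge ℓ r N
  edgeOf (m , i , j) (a , b) = edge m i j a b

  inD : EdgeType ℓ r → Fin N × Fin N → Bool
  inD (m , i , j) (a , b) = Ds m (i , a) (j , b)

  allEdges-ordered : All (Ordered ∘ typeOf) (allEdges Ds)
  allEdges-ordered = concat⁺ (map⁺ (All.universal (λ m → concat⁺ (map⁺ (All.tabulate (λ ij∈ →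
    map⁺ (All.universal (λ _ → ∈pairs⇒ascending ij∈) _))))) (allFin ℓ)))

  count-allEdges : ∀ (P : Edge ℓ r N → Bool) →
    count P (allEdges Ds) ≡ ∑ (λ τ → count (λ ab → inD τ ab ∧ P (edgeOf τ ab)) NN) edgeTypes
  count-allEdges P = begin
    count P (allEdges Ds)
      ≡⟨ ∑-concatMap (𝟙 ∘ P) _ (allFin ℓ) ⟩
    ∑ (λ m → count P (concatMap (λ ij → map (edgeOf (m , ij)) (filterᵇ (inD (m , ij)) NN)) (pairs r))) (allFin ℓ)
      ≡⟨ ∑-cong (allFin ℓ) (λ {m} _ → trans (∑-concatMap (𝟙 ∘ P) _ (pairs r)) (∑-cong (pairs r) (λ {ij} _ → block (m , ij)))) ⟩
    ∑ (λ m → ∑ (λ ij → count (λ ab → inD (m , ij) ab ∧ P (edgeOf (m , ij) ab)) NN) (pairs r)) (allFin ℓ)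
      ≡⟨ sym (∑-cartesianProduct _ (allFin ℓ) (pairs r)) ⟩
    ∑ (λ τ → count (λ ab → inD τ ab ∧ P (edgeOf τ ab)) NN) edgeTypes ∎
    where
    open ≡-Reasoning
    block : ∀ τ → count P (map (edgeOf τ) (filterᵇ (inD τ) NN)) ≡ count (λ ab → inD τ ab ∧ P (edgeOf τ ab)) NN
    block τ = trans (∑-map (𝟙 ∘ P) (edgeOf τ) (filterᵇ (inD τ) NN)) (count-filterᵇ (inD τ) (P ∘ edgeOf τ) NN)

  count-allEdges-ofType : ∀ t → Ordered t → (Q : Edge ℓ r N → Bool) →
    count (λ e → isOfType t e ∧ Q e) (allEdges Ds) ≡ count (λ ab → inD t ab ∧ Q (edgeOf t ab)) NN
  count-allEdges-ofType t o Q = begin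
    count (λ e → isOfType t e ∧ Q e) (allEdges Ds)
      ≡⟨ count-allEdges _ ⟩
    ∑ (λ τ → count (λ ab → inD τ ab ∧ (sameType t τ ∧ Q (edgeOf τ ab))) NN) edgeTypes
      ≡⟨ ∑-cong edgeTypes (λ {τ} _ → trans (∑-cong NN (λ {ab} _ → 𝟙-∧-left-comm (inD τ ab) (sameType t τ) (Q (edgeOf τ ab))))
                                           (∑-*ˡ (𝟙 (sameType t τ)) _ NN)) ⟩
    ∑ (λ τ → 𝟙 (sameType t τ) * block τ) edgeTypes
      ≡⟨ ∑-extract (sameType t) (λ τ → 𝟙 (sameType t τ) * block τ) (λ _ → 0) (block t) edgeTypes (count-sameType t o)
                   (λ {τ} _ t≢τ → cong (λ b → 𝟙 b * block τ) t≢τ) on ⟩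
    ∑ (λ _ → 0) (edgeTypes {ℓ} {r}) + block t
      ≡⟨ cong (_+ block t) (∑-const 0 (edgeTypes {ℓ} {r})) ⟩
    block t ∎
    where
    open ≡-Reasoning
    block : EdgeType ℓ r → ℕ
    block τ = count (λ ab → inD τ ab ∧ Q (edgeOf τ ab)) NN
    on : ∀ {τ} → sameType t τ ≡ true → 𝟙 (sameType t τ) * block τ ≡ 0 + block t
    on {τ} t≡τ with refl ← sameType⇒≡ {τ = t} {τ′ = τ} t≡τ rewrite sameType-refl t = +-identityʳ (block t)

  dCount≡count : ∀ t → Ordered t → dCount Ds ⟨ t ⟩ ≡ count (isOfType t) (allEdges Ds)
  dCount≡count t o = begin
    dCount Ds ⟨ t ⟩                                    ≡⟨ length-filterᵇ (inD t) NN ⟩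
    count (inD t) NN                                   ≡⟨ ∑-cong NN (λ {ab} _ → cong 𝟙 (sym (∧-identityʳ (inD t ab)))) ⟩
    count (λ ab → inD t ab ∧ true) NN                  ≡⟨ sym (count-allEdges-ofType t o (λ _ → true)) ⟩
    count (λ e → isOfType t e ∧ true) (allEdges Ds)    ≡⟨ ∑-cong (allEdges Ds) (λ {e} _ → cong 𝟙 (∧-identityʳ (isOfType t e))) ⟩
    count (isOfType t) (allEdges Ds)                   ∎
    where open ≡-Reasoning

  μ≡μAvoiding : ∀ x → μ Ds x ≡ μAvoiding (allEdges Ds) x []
  μ≡μAvoiding x = trans (length-filterᵇ (isXMatching x) (sublists (allEdges Ds)))
    (∑-cong (sublists (allEdges Ds)) (λ {M} _ → cong 𝟙 (sym (trans (cong (isXMatching x M ∧_) (∀∈-true⇒all-true _ M (λ _ → refl))) (∧-identityʳ _)))))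

  count-row≤degree : ∀ (D : Graph r N) v j → count (λ b → D v (j , b)) (allFin N) ≤ degree D v
  count-row≤degree D v j = subst (count (λ b → D v (j , b)) (allFin N) ≤_)
    (sym (trans (length-filterᵇ (D v) (allVertices r N)) (∑-cartesianProduct (𝟙 ∘ D v) (allFin r) (allFin N))))
    (∈⇒≤∑ (λ k → count (λ b → D v (k , b)) (allFin N)) (∈-allFin j))

  module _ {C : ℕ} (Δ≤C : ∀ m → MaxDegreeAtMost (Ds m) C) (symmetric : ∀ m u v → Ds m u v ≡ Ds m v u) where

    private
      noEdges : ∀ t → count (λ ab → inD t ab ∧ false) NN ≤ C
      noEdges t = subst (_≤ C) (sym (trans (∑-cong NN (λ {ab} _ → cong 𝟙 (∧-zeroʳ (inD t ab)))) (∑-const 0 NN))) z≤n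

    edgesAtFirst≤ : ∀ t → Ordered t → (w : Vertex r N) → count (λ e → isOfType t e ∧ vertexEq w (Edge.i e , Edge.a e)) (allEdges Ds) ≤ C
    edgesAtFirst≤ t@(m , i , j) o (k , c) rewrite count-allEdges-ofType t o (λ e → vertexEq (k , c) (Edge.i e , Edge.a e)) with finEq k i
    ... | false = noEdges t
    ... | true = begin
      count (λ ab → inD t ab ∧ finEq c (proj₁ ab)) NN  ≡⟨ count-finEq-proj₁ c (inD t) ⟩
      count (λ b → Ds m (i , c) (j , b)) (allFin N)    ≤⟨ count-row≤degree (Ds m) (i , c) j ⟩
      degree (Ds m) (i , c)                           ≤⟨ Δ≤C m (i , c) ⟩
      C                                               ∎
      where open ≤-Reasoning

    edgesAtSecond≤ : ∀ t → Ordered t → (w : Vertex r N) → count (λ e → isOfType t e ∧ vertexEq w (Edge.j e , Edge.b e)) (allEdges Ds) ≤ C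
    edgesAtSecond≤ t@(m , i , j) o (k , c) rewrite count-allEdges-ofType t o (λ e → vertexEq (k , c) (Edge.j e , Edge.b e)) with finEq k j
    ... | false = noEdges t
    ... | true = begin
      count (λ ab → inD t ab ∧ finEq c (proj₂ ab)) NN  ≡⟨ count-finEq-proj₂ c (inD t) ⟩
      count (λ a → Ds m (i , a) (j , c)) (allFin N)    ≡⟨ ∑-cong (allFin N) (λ {a} _ → cong 𝟙 (symmetric m (i , a) (j , c))) ⟩
      count (λ a → Ds m (j , c) (i , a)) (allFin N)    ≤⟨ count-row≤degree (Ds m) (j , c) i ⟩
      degree (Ds m) (j , c)                           ≤⟨ Δ≤C m (j , c) ⟩
      C                                               ∎
      where open ≤-Reasoning

    edgesMeeting≤ : ∀ t → Ordered t → (f : Edge ℓ r N) → count (λ e → isOfType t e ∧ shareVertex f e) (allEdges Ds) ≤ 4 * C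
    edgesMeeting≤ t o f = begin
      count (λ e → isOfType t e ∧ shareVertex f e) E
        ≤⟨ count-∧-∨ (isOfType t) (at u first) _ E ⟩
      meets u first + count (λ e → isOfType t e ∧ (at u second e ∨ at v first e ∨ at v second e)) E
        ≤⟨ +-monoʳ-≤ (meets u first) (count-∧-∨ (isOfType t) (at u second) _ E) ⟩
      meets u first + (meets u second + count (λ e → isOfType t e ∧ (at v first e ∨ at v second e)) E)
        ≤⟨ +-monoʳ-≤ (meets u first) (+-monoʳ-≤ (meets u second) (count-∧-∨ (isOfType t) (at v first) (at v second) E)) ⟩
      meets u first + (meets u second + (meets v first + meets v second))
        ≤⟨ +-mono-≤ (edgesAtFirst≤ t o u) (+-mono-≤ (edgesAtSecond≤ t o u) (+-mono-≤ (edgesAtFirst≤ t o v) (edgesAtSecond≤ t o v))) ⟩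
      C + (C + (C + C))
        ≡⟨ cong (λ k → C + (C + (C + k))) (sym (+-identityʳ C)) ⟩
      4 * C ∎
      where
      open ≤-Reasoning
      u v : Vertex r N
      u = Edge.i f , Edge.a f
      v = Edge.j f , Edge.b f
      first second : Edge ℓ r N → Vertex r N
      first e = Edge.i e , Edge.a e
      second e = Edge.j e , Edge.b e
      at : Vertex r N → (Edge ℓ r N → Vertex r N) → Edge ℓ r N → Bool
      at w end e = vertexEq w (end e)
      meets : Vertex r N → (Edge ℓ r N → Vertex r N) → ℕ
      meets w end = count (λ e → isOfType t e ∧ at w end e) E

    extensions≥ : ∀ x t → Ordered t → count (isOfType t) E * μAvoiding E x [] ≤ extensions E x [] t + 4 * C * norm x * μAvoiding E x []
    extensions≥ x t o = subst₂ _≤_ lhs rhs (∑-mono-≤ (sublists E) pointwise)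
      where
      d = count (isOfType t) E
      K = 4 * C * norm x
      pointwise : ∀ {M} → M ∈ sublists E →
        𝟙 (isXMatchingAvoiding x [] M) * d ≤ 𝟙 (isXMatchingAvoiding x [] M) * freeEdges E [] t M + K * 𝟙 (isXMatchingAvoiding x [] M)
      pointwise {M} M∈ with isXMatchingAvoiding x [] M in xM
      ... | false = z≤n
      ... | true = begin
        1 * d
          ≡⟨ *-identityˡ d ⟩
        d
          ≤⟨ count≤freeEdges+blocked E t M ⟩
        freeEdges E [] t M + ∑ (λ f → count (λ e → isOfType t e ∧ shareVertex f e) E) M
          ≤⟨ +-monoʳ-≤ (freeEdges E [] t M) (∑-mono-≤ M (λ {f} _ → edgesMeeting≤ t o f)) ⟩
        freeEdges E [] t M + ∑ (λ _ → 4 * C) M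
          ≡⟨ cong (freeEdges E [] t M +_) (trans (∑-const (4 * C) M) (cong (4 * C *_) |M|≡|x|)) ⟩
        freeEdges E [] t M + K
          ≡⟨ cong₂ _+_ (sym (*-identityˡ _)) (sym (*-identityʳ K)) ⟩
        1 * freeEdges E [] t M + K * 1 ∎
        where
        open ≤-Reasoning
        |M|≡|x| : length M ≡ norm x
        |M|≡|x| = length-xMatching x M (∧-conicalˡ (isXMatching x M) _ xM) (sublists-All allEdges-ordered M∈)
      lhs : ∑ (λ M → 𝟙 (isXMatchingAvoiding x [] M) * d) (sublists E) ≡ d * μAvoiding E x []
      lhs = trans (∑-*ʳ d (𝟙 ∘ isXMatchingAvoiding x []) (sublists E)) (*-comm (μAvoiding E x []) d)
      rhs : ∑ (λ M → 𝟙 (isXMatchingAvoiding x [] M) * freeEdges E [] t M + K * 𝟙 (isXMatchingAvoiding x [] M)) (sublists E)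
            ≡ extensions E x [] t + K * μAvoiding E x []
      rhs = trans (∑-+ _ _ (sublists E)) (cong (extensions E x [] t +_) (∑-*ˡ K (𝟙 ∘ isXMatchingAvoiding x []) (sublists E)))

    ShiftedPowerFormula : Vector ℓ r → Set
    ShiftedPowerFormula x = Σ (Shifts ℓ r) λ c →
      BoundedBy (ℕtoℚ (4 * C * norm x)) x c × ℕtoℚ (μ Ds x * factVec x) ≡ shiftedPower (dCount Ds) x c

    shiftedPowerFormula-zero : ∀ x → norm x ≡ 0 → ShiftedPowerFormula x
    shiftedPowerFormula-zero x |x|≡0 = (λ _ _ _ _ → 0ℚ) , bounded , formula
      where
      x≡0 : ∀ {τ} → τ ∈ edgeTypes → x ⟨ τ ⟩ ≡ 0
      x≡0 = ∑≡0⇒≡0 (x ⟨_⟩) (trans (sym (norm≡∑ x)) |x|≡0)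
      bounded : BoundedBy (ℕtoℚ (4 * C * norm x)) x (λ _ _ _ _ → 0ℚ)
      bounded m i j i<j k k<x with () ← subst (k <_) (x≡0 (Ordered⇒∈edgeTypes {t = m , i , j} i<j)) k<x
      formula : ℕtoℚ (μ Ds x * factVec x) ≡ shiftedPower (dCount Ds) x (λ _ _ _ _ → 0ℚ)
      formula = begin
        ℕtoℚ (μ Ds x * factVec x)
          ≡⟨ cong ℕtoℚ (cong₂ _*_ (trans (μ≡μAvoiding x) (μAvoiding-zero x x≡0 (allEdges Ds) allEdges-ordered []))
                                  (trans (factVec≡∏ x) (trans (∏-cong edgeTypes (λ τ∈ → cong _! (x≡0 τ∈))) (∏-ε (edgeTypes {ℓ} {r}))))) ⟩
        ℚ.1ℚ
          ≡⟨ sym (trans (shiftedPower≡∏ (dCount Ds) x (λ _ _ _ _ → 0ℚ))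
                        (trans (∏ℚ-cong edgeTypes (λ {τ} τ∈ → cong (λ n → ∏ℚ (λ _ → ℕtoℚ (dCount Ds ⟨ τ ⟩) -ℚ 0ℚ) (upTo n)) (x≡0 τ∈)))
                               (∏ℚ-ε (edgeTypes {ℓ} {r})))) ⟩
        shiftedPower (dCount Ds) x (λ _ _ _ _ → 0ℚ) ∎
        where open ≡-Reasoning

    shiftedPowerFormula-step : ∀ x s → Ordered s → 0 < x ⟨ s ⟩ → ShiftedPowerFormula (x ─ s) → ShiftedPowerFormula x
    shiftedPowerFormula-step x s o x>0 (c′ , c′-bounded , formula′) = setShift c′ s Y q , bounded , formula
      where
      x′ = x ─ s
      Y = x′ ⟨ s ⟩
      d = count (isOfType s) E
      X = x ⟨ s ⟩
      μx = μAvoiding E x []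
      μx′ = μAvoiding E x′ []

      X*μx≡ : X * μx ≡ extensions E x′ [] s
      X*μx≡ = double-counting E allEdges-ordered x [] s o x>0

      shift = sandwich⇒shift (X * μx) μx′ d (4 * C * norm x′)
        (subst (_≤ d * μx′) (sym X*μx≡) (extensions≤ E x′ s))
        (subst (λ n → d * μx′ ≤ n + 4 * C * norm x′ * μx′) (sym X*μx≡) (extensions≥ x′ s o))
      q = proj₁ shift

      4C|x′|≤4C|x| : ℕtoℚ (4 * C * norm x′) ≤ℚ ℕtoℚ (4 * C * norm x)
      4C|x′|≤4C|x| = ℕtoℚ-mono-≤ (*-monoʳ-≤ (4 * C) (subst (norm x′ ≤_) (sym (norm-─ x s o x>0)) (n≤1+n (norm x′))))

      bounded : BoundedBy (ℕtoℚ (4 * C * norm x)) x (setShift c′ s Y q)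
      bounded = setShift-bounded x s o x>0 c′ q (ℚ.≤-trans (proj₁ (proj₂ shift)) 4C|x′|≤4C|x|)
        (λ m i j i<j k k< → ℚ.≤-trans (c′-bounded m i j i<j k k<) 4C|x′|≤4C|x|)

      formula : ℕtoℚ (μ Ds x * factVec x) ≡ shiftedPower (dCount Ds) x (setShift c′ s Y q)
      formula = begin
        ℕtoℚ (μ Ds x * factVec x)
          ≡⟨ cong ℕtoℚ (cong₂ _*_ (μ≡μAvoiding x) (factVec-─ x s o x>0)) ⟩
        ℕtoℚ (μx * (factVec x′ * X))
          ≡⟨ ℕtoℚ-rescale μx (factVec x′) X μx′ (ℕtoℚ d -ℚ q) (proj₂ (proj₂ shift)) ⟩
        ℕtoℚ (μx′ * factVec x′) *ℚ (ℕtoℚ d -ℚ q)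
          ≡⟨ cong₂ (λ μ′ n → ℕtoℚ (μ′ * factVec x′) *ℚ (ℕtoℚ n -ℚ q)) (sym (μ≡μAvoiding x′)) (sym (dCount≡count s o)) ⟩
        ℕtoℚ (μ Ds x′ * factVec x′) *ℚ (ℕtoℚ (dCount Ds ⟨ s ⟩) -ℚ q)
          ≡⟨ cong (_*ℚ (ℕtoℚ (dCount Ds ⟨ s ⟩) -ℚ q)) formula′ ⟩
        shiftedPower (dCount Ds) x′ c′ *ℚ (ℕtoℚ (dCount Ds ⟨ s ⟩) -ℚ q)
          ≡⟨ sym (shiftedPower-setShift x s o x>0 (dCount Ds) c′ q) ⟩
        shiftedPower (dCount Ds) x (setShift c′ s Y q) ∎
        where open ≡-Reasoning

    shiftedPowerFormula : ∀ n x → norm x ≡ n → ShiftedPowerFormula x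
    shiftedPowerFormula zero x |x|≡0 = shiftedPowerFormula-zero x |x|≡0
    shiftedPowerFormula (suc n) x |x|≡1+n with ∑>0⇒∃ (x ⟨_⟩) edgeTypes (trans (sym (norm≡∑ x)) |x|≡1+n)
    ... | s , s∈ , x>0 = shiftedPowerFormula-step x s o x>0
          (shiftedPowerFormula n (x ─ s) (suc-injective (trans (sym (norm-─ x s o x>0)) |x|≡1+n)))
      where o = ∈edgeTypes⇒Ordered s∈

lemma4p5 : (C : ℕ) → Σ ℕ λ K →
    (r ℓ : ℕ) → 2 ≤ r → 1 ≤ ℓ →
    (n : ℕ) → (Ds : Fin ℓ → Graph r ((r ∸ 1) * n)) →
    (∀ m → IsSubgraphOfComplete (Ds m)) →
    PairwiseEdgeDisjoint Ds →
    (∀ m → MaxDegreeAtMost (Ds m) C) →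
    (x : Vector ℓ r) →
    Σ (Fin ℓ → Fin r → Fin r → ℕ → ℚ) λ c →
      (∀ m (i j : Fin r) → toℕ i < toℕ j → ∀ k → k < x m i j →
         ℚ.∣ c m i j k ∣ ℚ.≤ ℕtoℚ (K * norm x))
      × (ℕtoℚ (μ Ds x * factVec x) ≡ shiftedPower (dCount Ds) x c)
lemma4p5 C = 4 * C , λ r ℓ _ _ n Ds subgraph _ Δ≤C x →
  shiftedPowerFormula Ds Δ≤C (λ m → proj₁ (subgraph m)) (norm x) x refl
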